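{- For all integers $0\leq r\leq n$, \[k(r,n)=r!\,(n-r)!+\sum_{i=1}^{r}\sum_{j=1}^{n-r}\binom{n-i-j}{r-i}\cdot (r)_{i-1}\cdot(n-r)_{j-1}.\]
   Context: Let $\mathfrak{S}_n$ be the group of permutations of $\{1,\dots,n\}$, written in one-line notation $w=w(1)\cdots w(n)$. A permutation $w\in\mathfrak{S}_n$ contains the split pattern $3|12$ with respect to position $r$ if there are indices $i_1\leq r<i_2<i_3$ with $w(i_2)<w(i_3)<w(i_1)$; it contains the split pattern $23|1$ with respect to position $r$ if there are indices $i_1<i_2\leq r<i_3$ with $w(i_3)<w(i_1)<w(i_2)$. Otherwise it avoids the pattern with respect to position $r$. Let $K(r,n)$ be the set of $w\in\mathfrak{S}_n$ avoiding both $3|12$ and $23|1$ with respect to position $r$, and $k(r,n)=|K(r,n)|$, with the convention $k(0,0)=1$. For an integer $m$ and $i\geq 1$, $(m)_i=m(m-1)\cdots(m-i+1)$ is the falling factorial, and $(m)_0=1$. Empty sums are $0$. -}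

module Defs where

open import Data.Nat using (ℕ; zero; suc; _+_; _*_; _∸_; _<_; _≤_)
open import Data.Nat using (_!; _<?_; _≤?_)
open import Data.Nat.Combinatorics using (_C_)
import Data.Fin.Properties as FP
open import Relation.Nullary using (Dec)
open import Relation.Nullary.Decidable using (¬?; _×-dec_; _→-dec_)
open import Data.Fin using (Fin; toℕ)
open import Data.Vec using (Vec; []; _∷_; lookup)
open import Data.List using (List; []; _∷_; map; concatMap; filter; length; allFin)
open import Data.Product using (_×_; ∃; ∃-syntax)
open import Relation.Nullary using (¬_)
open import Relation.Unary using (Decidable)
open import Relation.Binary.PropositionalEquality using (_≡_)

Word : ℕ → Set
Word n = Vec (Fin n) n

IsPerm : ∀ {n} → Word n → Set
IsPerm {n} w = ∀ (i j : Fin n) → lookup w i ≡ lookup w j → i ≡ j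

-- Positions are 0-based: the paper's position p (1-based) is Fin index p-1,
-- so "i ≤ r" (1-based) becomes "toℕ i < r" (0-based).
Contains3|12 : ∀ {n} → ℕ → Word n → Set
Contains3|12 {n} r w =
  ∃[ i₁ ] ∃[ i₂ ] ∃[ i₃ ]
    (toℕ i₁ < r × r ≤ toℕ i₂ × toℕ i₂ < toℕ i₃ ×
     toℕ (lookup w i₂) < toℕ (lookup w i₃) × toℕ (lookup w i₃) < toℕ (lookup w i₁))

Contains23|1 : ∀ {n} → ℕ → Word n → Set
Contains23|1 {n} r w =
  ∃[ i₁ ] ∃[ i₂ ] ∃[ i₃ ]
    (toℕ i₁ < toℕ i₂ × toℕ i₂ < r × r ≤ toℕ i₃ ×
     toℕ (lookup w i₃) < toℕ (lookup w i₁) × toℕ (lookup w i₁) < toℕ (lookup w i₂))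

InK : ℕ → ∀ {n} → Word n → Set
InK r w = IsPerm w × ¬ Contains3|12 r w × ¬ Contains23|1 r w

allWords : ∀ {A : Set} → List A → (m : ℕ) → List (Vec A m)
allWords xs zero = [] ∷ []
allWords xs (suc m) = concatMap (λ x → map (x ∷_) (allWords xs m)) xs

inK? : (r : ℕ) → ∀ {n} → Decidable (InK r {n})
inK? r {n} w =
  FP.all? (λ i → FP.all? (λ j → (lookup w i FP.≟ lookup w j) →-dec (i FP.≟ j)))
  ×-dec (¬? (FP.any? λ i₁ → FP.any? λ i₂ → FP.any? λ i₃ →
     (toℕ i₁ <? r) ×-dec (r ≤? toℕ i₂) ×-dec (toℕ i₂ <? toℕ i₃) ×-dec
     (toℕ (lookup w i₂) <? toℕ (lookup w i₃)) ×-dec (toℕ (lookup w i₃) <? toℕ (lookup w i₁))))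
  ×-dec (¬? (FP.any? λ i₁ → FP.any? λ i₂ → FP.any? λ i₃ →
     (toℕ i₁ <? toℕ i₂) ×-dec (toℕ i₂ <? r) ×-dec (r ≤? toℕ i₃) ×-dec
     (toℕ (lookup w i₃) <? toℕ (lookup w i₁)) ×-dec (toℕ (lookup w i₁) <? toℕ (lookup w i₂))))

-- k(r,n): number of words in the (duplicate-free) enumeration of all of Fin n ^ n
-- that lie in K(r,n).
k : ℕ → ℕ → ℕ
k r n = length (filter (inK? r {n}) (allWords (allFin n) n))

ff : ℕ → ℕ → ℕ
ff m zero = 1
ff m (suc i) = (m ∸ i) * ff m i

Σ₁ : ℕ → (ℕ → ℕ) → ℕ
Σ₁ zero f = 0
Σ₁ (suc a) f = Σ₁ a f + f (suc a)

rhs : ℕ → ℕ → ℕ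
rhs r n = (r !) * ((n ∸ r) !)
        + Σ₁ r (λ i → Σ₁ (n ∸ r) (λ j →
            ((n ∸ i ∸ j) C (r ∸ i)) * ff r (i ∸ 1) * ff (n ∸ r) (j ∸ 1)))

{-# OPTIONS --safe #-}
-- For w in K(r,n) let m be the least value right of position r and M − 1 the largest value left
-- of it (values and positions count from 0).  Avoiding 3|12 says that the right values below
-- M − 1 come in decreasing order, avoiding 23|1 that the left values above m do.  These
-- conditions, together with all values below m lying on the left, characterise K(r,n), so
-- K(r,n) is the disjoint union over the pairs (m, M) of the words accepted by an automaton
-- checking them letter by letter.  The number of accepted completions of a state depends only
-- on a few counts of unseen values and is a binomial coefficient times falling factorials; this
-- is proved by induction on the number of letters left, via Pascal-type recurrences.  The pair
-- m = M = r contributes r!(n−r)!; every other pair has m + 2 ≤ M and contributes the (i, j)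
-- term of the double sum with i = m + 1 and j = n − M + 1.
module Submission where

open import Defs
open import Data.Nat using (ℕ; zero; suc; _+_; _*_; _∸_; _<_; _≤_; _≮_; _!; _≟_; _<?_; _≤?_; z≤n; s≤s; s<s; s<s⁻¹; pred)
open import Data.Nat.Properties
open import Data.Nat.Combinatorics using (_C_; nCk+nC[k+1]≡[n+1]C[k+1]; k>n⇒nCk≡0)
open import Data.Fin as Fin using (Fin; toℕ)
open import Data.Fin.Properties as FinP using (toℕ<n)
open import Data.List using (List; []; _∷_; _++_; map; concatMap; filter; length; tabulate; allFin)
open import Data.Vec using (Vec; []; _∷_; lookup)
open import Data.List.Membership.Propositional using (_∈_; _∉_)
open import Data.List.Membership.DecPropositional _≟_ using (_∈?_)
open import Data.List.Relation.Unary.All as All using (All; []; _∷_; all?)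
open import Data.List.Relation.Unary.Any using (here; there)
open import Data.List.Membership.Propositional.Properties using (∈-map⁺; ∈-map⁻; ∈-filter⁺; ∈-filter⁻; ∈-allFin)
open import Data.List.Extrema.Nat using (min; max; argmin-sel; argmax-sel; min≤⊤; min≤xs; xs≤max; max≤v⁺)
open import Data.Product using (_×_; _,_; proj₁; proj₂; ∃; swap)
open import Data.Sum as Sum using (_⊎_; inj₁; inj₂; [_,_]′)
open import Data.Empty using (⊥-elim)
open import Function using (_∘_; id; flip)
open import Relation.Nullary using (Dec; yes; no; ¬_; contradiction)
open import Relation.Nullary.Decidable using (_×-dec_; _→-dec_; _⊎-dec_; ¬?; decidable-stable)
open import Relation.Unary using (Decidable)
open import Relation.Binary.Definitions using (Tri; tri<; tri≈; tri>)
open import Relation.Binary.PropositionalEquality using (_≡_; _≢_; refl; sym; trans; cong; cong₂; subst; module ≡-Reasoning)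
open import Algebra.Properties.CommutativeSemigroup +-commutativeSemigroup using () renaming (interchange to +-interchange)
open import Algebra.Properties.CommutativeSemigroup *-commutativeSemigroup using () renaming (x∙yz≈y∙xz to *-x∙yz≈y∙xz)
open ≡-Reasoning

∉-∷⁺ : ∀ {v x : ℕ} {xs} → v ≢ x → v ∉ xs → v ∉ x ∷ xs
∉-∷⁺ v≢x v∉xs (here v≡x)   = v≢x v≡x
∉-∷⁺ v≢x v∉xs (there v∈xs) = v∉xs v∈xs

∉-∷⁻ : ∀ {v x : ℕ} {xs} → v ∉ x ∷ xs → v ≢ x × v ∉ xs
∉-∷⁻ v∉x∷xs = v∉x∷xs ∘ here , v∉x∷xs ∘ there

<pred⇒suc< : ∀ {x K} → x < pred K → suc x < K
<pred⇒suc< {K = suc K} x<K = s≤s x<K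

suc<⇒<pred : ∀ {x K} → suc x < K → x < pred K
suc<⇒<pred {K = suc K} (s≤s x<K) = x<K

≮∧≢⇒> : ∀ {x y} → x ≮ y → x ≢ y → y < x
≮∧≢⇒> x≮y x≢y = ≤∧≢⇒< (≮⇒≥ x≮y) (x≢y ∘ sym)

∸-swap : ∀ n a b → n ∸ a ∸ b ≡ n ∸ b ∸ a
∸-swap n a b = trans (∸-+-assoc n a b) (trans (cong (n ∸_) (+-comm a b)) (sym (∸-+-assoc n b a)))

≮∧≯⇒≡ : ∀ {x y} → x ≮ y → y ≮ x → x ≡ y
≮∧≯⇒≡ x≮y y≮x = ≤-antisym (≮⇒≥ y≮x) (≮⇒≥ x≮y)

pred<⇒≤ : ∀ {K x} → pred K < x → K ≤ x
pred<⇒≤ {zero}  _   = z≤n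
pred<⇒≤ {suc K} K<x = K<x

pred< : ∀ {x K} → x < pred K → pred K < K
pred< {K = suc K} _ = n<1+n K

<∧≢pred⇒suc< : ∀ {x K} → x < K → x ≢ pred K → suc x < K
<∧≢pred⇒suc< {x} {suc K} x<1+K x≢K = s≤s (≤∧≢⇒< (≤-pred x<1+K) x≢K)

Fin-injective⇒surjective : ∀ {n} (f : Fin n → Fin n) → (∀ {i j} → f i ≡ f j → i ≡ j) → ∀ y → ∃ λ i → f i ≡ y
Fin-injective⇒surjective {suc n} f f-inj y with FinP.any? (λ i → f i FinP.≟ y)
... | yes ∃i = ∃i
... | no ∄i  = contradiction (FinP.injective⇒≤ g-injective) (<-irrefl refl)
  where
  y≢f : ∀ i → y ≢ f i
  y≢f i y≡fi = ∄i (i , sym y≡fi)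
  g : Fin (suc n) → Fin n
  g i = Fin.punchOut (y≢f i)
  g-injective : ∀ {i j} → g i ≡ g j → i ≡ j
  g-injective {i} {j} gi≡gj = f-inj (FinP.punchOut-injective (y≢f i) (y≢f j) gi≡gj)

-- Finite sums and counting

Σ< : ℕ → (ℕ → ℕ) → ℕ
Σ< zero    f = 0
Σ< (suc N) f = Σ< N f + f N

Σ<-cong : ∀ N {f g : ℕ → ℕ} → (∀ v → v < N → f v ≡ g v) → Σ< N f ≡ Σ< N g
Σ<-cong zero    f≗g = refl
Σ<-cong (suc N) f≗g = cong₂ _+_ (Σ<-cong N (λ v v<N → f≗g v (m<n⇒m<1+n v<N))) (f≗g N ≤-refl)

Σ<-distrib-+ : ∀ N (f g : ℕ → ℕ) → Σ< N (λ v → f v + g v) ≡ Σ< N f + Σ< N g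
Σ<-distrib-+ zero    f g = refl
Σ<-distrib-+ (suc N) f g =
  trans (cong (_+ (f N + g N)) (Σ<-distrib-+ N f g)) (+-interchange (Σ< N f) (Σ< N g) (f N) (g N))

Σ<-*ˡ : ∀ N c (f : ℕ → ℕ) → Σ< N (λ v → c * f v) ≡ c * Σ< N f
Σ<-*ˡ zero    c f = sym (*-zeroʳ c)
Σ<-*ˡ (suc N) c f = trans (cong (_+ c * f N) (Σ<-*ˡ N c f)) (sym (*-distribˡ-+ c (Σ< N f) (f N)))

Σ<-*ʳ : ∀ N c (f : ℕ → ℕ) → Σ< N (λ v → f v * c) ≡ Σ< N f * c
Σ<-*ʳ N c f = trans (Σ<-cong N (λ v _ → *-comm (f v) c)) (trans (Σ<-*ˡ N c f) (*-comm c (Σ< N f)))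

Σ<-const : ∀ N c → Σ< N (λ _ → c) ≡ N * c
Σ<-const zero    c = refl
Σ<-const (suc N) c = trans (cong (_+ c) (Σ<-const N c)) (+-comm (N * c) c)

Σ<-zero : ∀ N {f : ℕ → ℕ} → (∀ v → v < N → f v ≡ 0) → Σ< N f ≡ 0
Σ<-zero N f≗0 = trans (Σ<-cong N f≗0) (trans (Σ<-const N 0) (*-zeroʳ N))

Σ<-single : ∀ N {f : ℕ → ℕ} x → x < N → (∀ v → v < N → v ≢ x → f v ≡ 0) → Σ< N f ≡ f x
Σ<-single (suc N) {f} x x<1+N f≗0 with x ≟ N
... | yes refl = cong (_+ f x) (Σ<-zero N (λ v v<N → f≗0 v (m<n⇒m<1+n v<N) (<⇒≢ v<N)))
... | no x≢N   = trans (cong₂ _+_ (Σ<-single N x (≤∧≢⇒< (≤-pred x<1+N) x≢N) (λ v v<N → f≗0 v (m<n⇒m<1+n v<N)))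
                                  (f≗0 N ≤-refl (x≢N ∘ sym)))
                       (+-identityʳ (f x))

Σ<-suc : ∀ N (f : ℕ → ℕ) → Σ< (suc N) f ≡ f 0 + Σ< N (f ∘ suc)
Σ<-suc zero    f = sym (+-identityʳ (f 0))
Σ<-suc (suc N) f = trans (cong (_+ f (suc N)) (Σ<-suc N f)) (+-assoc (f 0) _ _)

Σ<-+ : ∀ p q (f : ℕ → ℕ) → Σ< (p + q) f ≡ Σ< p f + Σ< q (λ j → f (p + j))
Σ<-+ p zero    f = trans (cong (λ N → Σ< N f) (+-identityʳ p)) (sym (+-identityʳ _))
Σ<-+ p (suc q) f = begin
  Σ< (p + suc q) f                                ≡⟨ cong (λ N → Σ< N f) (+-suc p q) ⟩
  Σ< (p + q) f + f (p + q)                        ≡⟨ cong (_+ f (p + q)) (Σ<-+ p q f) ⟩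
  Σ< p f + Σ< q (λ j → f (p + j)) + f (p + q)     ≡⟨ +-assoc (Σ< p f) _ _ ⟩
  Σ< p f + (Σ< q (λ j → f (p + j)) + f (p + q))   ∎

Σ<-reverse : ∀ N (f : ℕ → ℕ) → Σ< N (λ j → f (N ∸ suc j)) ≡ Σ< N f
Σ<-reverse zero    f = refl
Σ<-reverse (suc N) f = begin
  Σ< N (λ j → f (N ∸ j)) + f (N ∸ N)           ≡⟨ cong₂ _+_ (Σ<-cong N (λ j j<N → cong f (+-∸-assoc 1 j<N)))
                                                             (cong f (n∸n≡0 N)) ⟩
  Σ< N (λ j → f (suc (N ∸ suc j))) + f 0       ≡⟨ cong (_+ f 0) (Σ<-reverse N (f ∘ suc)) ⟩
  Σ< N (f ∘ suc) + f 0                         ≡⟨ +-comm _ (f 0) ⟩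
  f 0 + Σ< N (f ∘ suc)                         ≡⟨ Σ<-suc N f ⟨
  Σ< (suc N) f                                 ∎

Σ<-mono-≤ : ∀ N {f g : ℕ → ℕ} → (∀ v → v < N → f v ≤ g v) → Σ< N f ≤ Σ< N g
Σ<-mono-≤ zero    f≤g = z≤n
Σ<-mono-≤ (suc N) f≤g = +-mono-≤ (Σ<-mono-≤ N (λ v v<N → f≤g v (m<n⇒m<1+n v<N))) (f≤g N ≤-refl)

Σ<-truncate : ∀ K N {f : ℕ → ℕ} → K ≤ N → (∀ v → K ≤ v → v < N → f v ≡ 0) → Σ< N f ≡ Σ< K f
Σ<-truncate K N {f} K≤N tail≗0 with o , refl ← m≤n⇒∃[o]m+o≡n K≤N =
  trans (Σ<-+ K o f)
        (trans (cong (Σ< K f +_) (Σ<-zero o (λ j j<o → tail≗0 (K + j) (m≤m+n K j) (+-monoʳ-< K j<o))))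
               (+-identityʳ _))

Σ₁≡Σ< : ∀ a (f : ℕ → ℕ) → Σ₁ a f ≡ Σ< a (f ∘ suc)
Σ₁≡Σ< zero    f = refl
Σ₁≡Σ< (suc a) f = cong (_+ f (suc a)) (Σ₁≡Σ< a f)

r+e∸[e∸1+j] : ∀ r {e j} → j < e → r + e ∸ (e ∸ suc j) ≡ suc r + j
r+e∸[e∸1+j] r {j = j} j<e with d , refl ← m≤n⇒∃[o]m+o≡n j<e = begin
  r + (suc j + d) ∸ (suc j + d ∸ suc j)    ≡⟨ cong (r + (suc j + d) ∸_) (m+n∸m≡n (suc j) d) ⟩
  r + (suc j + d) ∸ d                      ≡⟨ cong (_∸ d) (+-assoc r (suc j) d) ⟨
  r + suc j + d ∸ d                        ≡⟨ m+n∸n≡m (r + suc j) d ⟩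
  r + suc j                                ≡⟨ +-suc r j ⟩
  suc r + j                                ∎

Σ<-reverse-tail : ∀ r e (f : ℕ → ℕ) → (∀ M → M ≤ r → f M ≡ 0) → Σ< (suc (r + e)) f ≡ Σ< e (λ j → f (r + e ∸ j))
Σ<-reverse-tail r e f head≡0 = begin
  Σ< (suc r + e) f                                ≡⟨ Σ<-+ (suc r) e f ⟩
  Σ< (suc r) f + Σ< e (λ j → f (suc r + j))       ≡⟨ cong (_+ Σ< e (λ j → f (suc r + j)))
                                                            (Σ<-zero (suc r) (λ M M<1+r → head≡0 M (≤-pred M<1+r))) ⟩
  Σ< e (λ j → f (suc r + j))                      ≡⟨ Σ<-cong e (λ j j<e → cong f (r+e∸[e∸1+j] r j<e)) ⟨
  Σ< e (λ j → f (r + e ∸ (e ∸ suc j)))            ≡⟨ Σ<-reverse e (λ j → f (r + e ∸ j)) ⟩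
  Σ< e (λ j → f (r + e ∸ j))                      ∎

𝟙 : ∀ {p} {P : Set p} → Dec P → ℕ
𝟙 (yes _) = 1
𝟙 (no _)  = 0

module _ {p} {P : Set p} where

  𝟙-yes : (d : Dec P) → P → 𝟙 d ≡ 1
  𝟙-yes (yes _) _  = refl
  𝟙-yes (no ¬p) p = contradiction p ¬p

  𝟙-no : (d : Dec P) → ¬ P → 𝟙 d ≡ 0
  𝟙-no (yes p) ¬p = contradiction p ¬p
  𝟙-no (no _)  _  = refl

  𝟙≡1⇒ : (d : Dec P) → 𝟙 d ≡ 1 → P
  𝟙≡1⇒ (yes p) _ = p

  𝟙-cong : ∀ {q} {Q : Set q} (d : Dec P) (d′ : Dec Q) → (P → Q) → (Q → P) → 𝟙 d ≡ 𝟙 d′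
  𝟙-cong (yes _) (yes _) _ _ = refl
  𝟙-cong (yes p) (no ¬q) f _ = contradiction (f p) ¬q
  𝟙-cong (no ¬p) (yes q) _ g = contradiction (g q) ¬p
  𝟙-cong (no _)  (no _)  _ _ = refl

  𝟙*-cong : (d : Dec P) {x y : ℕ} → (P → x ≡ y) → 𝟙 d * x ≡ 𝟙 d * y
  𝟙*-cong (yes p) x≡y = cong (_+ 0) (x≡y p)
  𝟙*-cong (no _)  _   = refl

  𝟙-⊎ : ∀ {q s} {Q : Set q} {R : Set s} (d : Dec P) (dq : Dec Q) (dr : Dec R) →
        (P → Q ⊎ R) → (Q → P) → (R → P) → (Q → ¬ R) → 𝟙 d ≡ 𝟙 dq + 𝟙 dr
  𝟙-⊎ (yes _) (yes q) (yes r) _ _ _ q∩r = contradiction r (q∩r q)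
  𝟙-⊎ (yes _) (yes _) (no _)  _ _ _ _   = refl
  𝟙-⊎ (yes _) (no _)  (yes _) _ _ _ _   = refl
  𝟙-⊎ (yes p) (no ¬q) (no ¬r) f _ _ _   = ⊥-elim ([ ¬q , ¬r ]′ (f p))
  𝟙-⊎ (no ¬p) (yes q) _       _ g _ _   = contradiction (g q) ¬p
  𝟙-⊎ (no ¬p) (no _)  (yes r) _ _ h _   = contradiction (h r) ¬p
  𝟙-⊎ (no _)  (no _)  (no _)  _ _ _ _   = refl

  𝟙-mono : ∀ {q} {Q : Set q} (d : Dec P) (d′ : Dec Q) → (P → Q) → 𝟙 d ≤ 𝟙 d′
  𝟙-mono (yes p) (yes _) _ = ≤-refl
  𝟙-mono (yes p) (no ¬q) f = contradiction (f p) ¬q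
  𝟙-mono (no _)  _       _ = z≤n

count : ∀ {p} {P : ℕ → Set p} → ℕ → Decidable P → ℕ
count N P? = Σ< N (λ v → 𝟙 (P? v))

module _ {p q} {P : ℕ → Set p} {Q : ℕ → Set q} (P? : Decidable P) (Q? : Decidable Q) where

  count-cong : ∀ N → (∀ v → v < N → P v → Q v) → (∀ v → v < N → Q v → P v) → count N P? ≡ count N Q?
  count-cong N P⇒Q Q⇒P = Σ<-cong N (λ v v<N → 𝟙-cong (P? v) (Q? v) (P⇒Q v v<N) (Q⇒P v v<N))

  count-insert : ∀ N x → x < N → Q x →
                 (∀ v → v < N → P v → Q v × v ≢ x) → (∀ v → v < N → Q v → v ≢ x → P v) →
                 suc (count N P?) ≡ count N Q?
  count-insert N x x<N Qx P⇒Q Q⇒P = begin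
    suc (count N P?)                                ≡⟨ +-comm 1 (count N P?) ⟩
    count N P? + 1                                  ≡⟨ cong (count N P? +_) [x]≡1 ⟨
    count N P? + count N (_≟ x)                     ≡⟨ Σ<-distrib-+ N _ _ ⟨
    Σ< N (λ v → 𝟙 (P? v) + 𝟙 (v ≟ x))               ≡⟨ Σ<-cong N (λ v v<N → sym (split v v<N)) ⟩
    count N Q?                                      ∎
    where
    [x]≡1 : count N (_≟ x) ≡ 1
    [x]≡1 = trans (Σ<-single N x x<N (λ v _ v≢x → 𝟙-no (v ≟ x) v≢x)) (𝟙-yes (x ≟ x) refl)
    split : ∀ v → v < N → 𝟙 (Q? v) ≡ 𝟙 (P? v) + 𝟙 (v ≟ x)
    split v v<N = 𝟙-⊎ (Q? v) (P? v) (v ≟ x) Q⇒P∨x (proj₁ ∘ P⇒Q v v<N) (λ { refl → Qx }) (proj₂ ∘ P⇒Q v v<N)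
      where
      Q⇒P∨x : Q v → P v ⊎ v ≡ x
      Q⇒P∨x Qv with v ≟ x
      ... | yes v≡x = inj₂ v≡x
      ... | no v≢x  = inj₁ (Q⇒P v v<N Qv v≢x)

module _ {p} {P : ℕ → Set p} (P? : Decidable P) where

  count≡0 : ∀ N → (∀ v → v < N → ¬ P v) → count N P? ≡ 0
  count≡0 N none = Σ<-zero N (λ v v<N → 𝟙-no (P? v) (none v v<N))

  count≡0⇒ : ∀ N → count N P? ≡ 0 → ∀ v → v < N → ¬ P v
  count≡0⇒ (suc N) count≡0 v v<1+N Pv with m≤n⇒m<n∨m≡n (≤-pred v<1+N)
  ... | inj₁ v<N  = count≡0⇒ N (m+n≡0⇒m≡0 _ count≡0) v v<N Pv
  ... | inj₂ refl = 0≢1+n (trans (sym (m+n≡0⇒n≡0 (count v P?) count≡0)) (𝟙-yes (P? v) Pv))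

  Σ<-𝟙*-const : ∀ N (f : ℕ → ℕ) c → (∀ v → v < N → P v → f v ≡ c) →
                Σ< N (λ v → 𝟙 (P? v) * f v) ≡ count N P? * c
  Σ<-𝟙*-const N f c f≡c = trans (Σ<-cong N (λ v v<N → 𝟙*-cong (P? v) (f≡c v v<N))) (Σ<-*ʳ N c (λ v → 𝟙 (P? v)))

  -- An element x of P has rank count x P? among the elements of P.
  Σ<-rank : ∀ N (g : ℕ → ℕ) → Σ< N (λ x → 𝟙 (P? x) * g (count x P?)) ≡ Σ< (count N P?) g
  Σ<-rank zero    g = refl
  Σ<-rank (suc N) g with P? N
  ... | yes _ = trans (cong₂ _+_ (Σ<-rank N g) (+-identityʳ _)) (cong (λ K → Σ< K g) (+-comm 1 (count N P?)))
  ... | no _  = trans (+-identityʳ _) (trans (Σ<-rank N g) (cong (λ K → Σ< K g) (sym (+-identityʳ (count N P?)))))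

module _ {p} {P : ℕ → Set p} (P? : Decidable P) where

  IsMaxBelow : ℕ → ℕ → Set p
  IsMaxBelow K x = P x × x < K × (∀ {y} → y < K → P y → y ≤ x)

  isMaxBelow? : ∀ K → Decidable (IsMaxBelow K)
  isMaxBelow? K x = P? x ×-dec x <? K ×-dec allUpTo? (λ y → P? y →-dec y ≤? x) K

  count-isMaxBelow-none : ∀ K N → (∀ y → y < K → ¬ P y) → count N (isMaxBelow? K) ≡ 0
  count-isMaxBelow-none K N none = count≡0 (isMaxBelow? K) N (λ v _ (Pv , v<K , _) → none v v<K Pv)

  count-isMaxBelow : ∀ K N → K ≤ N → (∃ λ y → y < K × P y) → count N (isMaxBelow? K) ≡ 1
  count-isMaxBelow K N K≤N ∃y =
    trans (Σ<-truncate K N K≤N (λ v K≤v _ → 𝟙-no (isMaxBelow? K v) (λ (_ , v<K , _) → <⇒≱ v<K K≤v)))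
          (count-isMaxBelow-below K ∃y)
    where
    count-isMaxBelow-below : ∀ K → (∃ λ y → y < K × P y) → count K (isMaxBelow? K) ≡ 1
    count-isMaxBelow-below (suc K) ∃y = by-cases (P? K)
      where
      by-cases : Dec (P K) → count (suc K) (isMaxBelow? (suc K)) ≡ 1
      by-cases (yes PK) =
        cong₂ _+_ (count≡0 (isMaxBelow? (suc K)) K (λ v v<K (_ , _ , max) → <⇒≱ v<K (max ≤-refl PK)))
                  (𝟙-yes (isMaxBelow? (suc K) K) (PK , ≤-refl , λ y<1+K _ → ≤-pred y<1+K))
      by-cases (no ¬PK) =
        cong₂ _+_ (trans (count-cong (isMaxBelow? (suc K)) (isMaxBelow? K) K shrink widen)
                         (count-isMaxBelow-below K (below ∃y)))
                  (𝟙-no (isMaxBelow? (suc K) K) (¬PK ∘ proj₁))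
        where
        below<1+K : ∀ {y} → y < suc K → P y → y < K
        below<1+K y<1+K Py with m≤n⇒m<n∨m≡n (≤-pred y<1+K)
        ... | inj₁ y<K  = y<K
        ... | inj₂ refl = contradiction Py ¬PK
        below : (∃ λ y → y < suc K × P y) → ∃ λ y → y < K × P y
        below (y , y<1+K , Py) = y , below<1+K y<1+K Py , Py
        shrink : ∀ v → v < K → IsMaxBelow (suc K) v → IsMaxBelow K v
        shrink v v<K (Pv , _ , max) = Pv , v<K , (λ y<K → max (m<n⇒m<1+n y<K))
        widen : ∀ v → v < K → IsMaxBelow K v → IsMaxBelow (suc K) v
        widen v v<K (Pv , _ , max) = Pv , m<n⇒m<1+n v<K , (λ y<1+K Py → max (below<1+K y<1+K Py) Py)

Σ<-𝟙-split : ∀ {p q s} {P : ℕ → Set p} {Q : ℕ → Set q} {R : ℕ → Set s}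
             (P? : Decidable P) (Q? : Decidable Q) (R? : Decidable R) N (f : ℕ → ℕ) →
             (∀ x → 𝟙 (P? x) ≡ 𝟙 (Q? x) + 𝟙 (R? x)) →
             Σ< N (λ x → 𝟙 (P? x) * f x) ≡ Σ< N (λ x → 𝟙 (Q? x) * f x) + Σ< N (λ x → 𝟙 (R? x) * f x)
Σ<-𝟙-split P? Q? R? N f split =
  trans (Σ<-cong N (λ x _ → trans (cong (_* f x) (split x)) (*-distribʳ-+ (f x) (𝟙 (Q? x)) (𝟙 (R? x)))))
        (Σ<-distrib-+ N _ _)

count-≥ : ∀ N lo → count N (lo ≤?_) ≡ N ∸ lo
count-≥ zero    lo = sym (0∸n≡0 lo)
count-≥ (suc N) lo with lo ≤? N
... | yes lo≤N = trans (cong (_+ 1) (count-≥ N lo)) (trans (+-comm (N ∸ lo) 1) (sym (+-∸-assoc 1 lo≤N)))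
... | no lo≰N  = trans (+-identityʳ _) (trans (count-≥ N lo)
                   (trans (m≤n⇒m∸n≡0 (<⇒≤ (≰⇒> lo≰N))) (sym (m≤n⇒m∸n≡0 (≰⇒> lo≰N)))))

count-range : ∀ N lo hi → hi ≤ N → count N (λ v → lo ≤? v ×-dec v <? hi) ≡ hi ∸ lo
count-range N lo hi hi≤N =
  trans (Σ<-truncate hi N hi≤N (λ v hi≤v _ → 𝟙-no (lo ≤? v ×-dec v <? hi) (λ (_ , v<hi) → <⇒≱ v<hi hi≤v)))
        (trans (count-cong (λ v → lo ≤? v ×-dec v <? hi) (lo ≤?_) hi (λ _ _ → proj₁) (λ _ v<hi lo≤v → lo≤v , v<hi))
               (count-≥ hi lo))

Σᴸ : ∀ {a} {A : Set a} → (A → ℕ) → List A → ℕ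
Σᴸ f []       = 0
Σᴸ f (x ∷ xs) = f x + Σᴸ f xs

module _ {a} {A : Set a} where

  Σᴸ-cong : ∀ {f g : A → ℕ} xs → (∀ x → f x ≡ g x) → Σᴸ f xs ≡ Σᴸ g xs
  Σᴸ-cong []       f≗g = refl
  Σᴸ-cong (x ∷ xs) f≗g = cong₂ _+_ (f≗g x) (Σᴸ-cong xs f≗g)

  Σᴸ-++ : ∀ (f : A → ℕ) xs ys → Σᴸ f (xs ++ ys) ≡ Σᴸ f xs + Σᴸ f ys
  Σᴸ-++ f []       ys = refl
  Σᴸ-++ f (x ∷ xs) ys = trans (cong (f x +_) (Σᴸ-++ f xs ys)) (sym (+-assoc (f x) _ _))

  Σᴸ-map : ∀ {b} {B : Set b} (f : A → ℕ) (h : B → A) ys → Σᴸ f (map h ys) ≡ Σᴸ (f ∘ h) ys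
  Σᴸ-map f h []       = refl
  Σᴸ-map f h (y ∷ ys) = cong (f (h y) +_) (Σᴸ-map f h ys)

  Σᴸ-concatMap : ∀ {b} {B : Set b} (f : A → ℕ) (g : B → List A) ys →
                 Σᴸ f (concatMap g ys) ≡ Σᴸ (Σᴸ f ∘ g) ys
  Σᴸ-concatMap f g []       = refl
  Σᴸ-concatMap f g (y ∷ ys) = trans (Σᴸ-++ f (g y) (concatMap g ys)) (cong (Σᴸ f (g y) +_) (Σᴸ-concatMap f g ys))

  Σᴸ-*ˡ : ∀ c (f : A → ℕ) xs → Σᴸ (λ x → c * f x) xs ≡ c * Σᴸ f xs
  Σᴸ-*ˡ c f []       = sym (*-zeroʳ c)
  Σᴸ-*ˡ c f (x ∷ xs) = trans (cong (c * f x +_) (Σᴸ-*ˡ c f xs)) (sym (*-distribˡ-+ c (f x) _))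

  Σᴸ-distrib-+ : ∀ (f g : A → ℕ) xs → Σᴸ (λ x → f x + g x) xs ≡ Σᴸ f xs + Σᴸ g xs
  Σᴸ-distrib-+ f g []       = refl
  Σᴸ-distrib-+ f g (x ∷ xs) = trans (cong (f x + g x +_) (Σᴸ-distrib-+ f g xs)) (+-interchange (f x) (g x) _ _)

  Σᴸ-Σ< : ∀ N (f : ℕ → A → ℕ) xs → Σᴸ (λ x → Σ< N (λ i → f i x)) xs ≡ Σ< N (λ i → Σᴸ (f i) xs)
  Σᴸ-Σ< zero    f []       = refl
  Σᴸ-Σ< zero    f (x ∷ xs) = Σᴸ-Σ< zero f xs
  Σᴸ-Σ< (suc N) f xs       =
    trans (Σᴸ-distrib-+ (λ x → Σ< N (λ i → f i x)) (f N) xs) (cong (_+ Σᴸ (f N) xs) (Σᴸ-Σ< N f xs))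

  Σᴸ-tabulate : ∀ n (h : A → ℕ) (f : Fin n → A) (g : ℕ → ℕ) → (∀ i → h (f i) ≡ g (toℕ i)) →
                Σᴸ h (tabulate f) ≡ Σ< n g
  Σᴸ-tabulate zero    h f g hf≗g = refl
  Σᴸ-tabulate (suc n) h f g hf≗g =
    trans (cong₂ _+_ (hf≗g Fin.zero) (Σᴸ-tabulate n h (f ∘ Fin.suc) (g ∘ suc) (hf≗g ∘ Fin.suc))) (sym (Σ<-suc n g))

  length-filter : ∀ {p} {P : A → Set p} (P? : Decidable P) xs → length (filter P? xs) ≡ Σᴸ (λ x → 𝟙 (P? x)) xs
  length-filter P? []       = refl
  length-filter P? (x ∷ xs) with P? x
  ... | yes _ = cong suc (length-filter P? xs)
  ... | no _  = length-filter P? xs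

Σᴸ-allFin : ∀ n (g : ℕ → ℕ) → Σᴸ (g ∘ toℕ) (allFin n) ≡ Σ< n g
Σᴸ-allFin n g = Σᴸ-tabulate n (g ∘ toℕ) id g (λ _ → refl)

Σᴸ-allWords-suc : ∀ {A : Set} (xs : List A) q (f : Vec A (suc q) → ℕ) →
                  Σᴸ f (allWords xs (suc q)) ≡ Σᴸ (λ x → Σᴸ (f ∘ (x ∷_)) (allWords xs q)) xs
Σᴸ-allWords-suc xs q f =
  trans (Σᴸ-concatMap f (λ x → map (x ∷_) (allWords xs q)) xs) (Σᴸ-cong xs (λ x → Σᴸ-map f (x ∷_) (allWords xs q)))

-- Falling factorials and binomial coefficients

ff-suc-suc : ∀ k a → ff (suc k) (suc a) ≡ suc k * ff k a
ff-suc-suc k zero    = refl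
ff-suc-suc k (suc a) = trans (cong ((k ∸ a) *_) (ff-suc-suc k a)) (*-x∙yz≈y∙xz (k ∸ a) (suc k) (ff k a))

ff-vanish : ∀ {k a} → k < a → ff k a ≡ 0
ff-vanish {k} {suc a} k<1+a with m≤n⇒m<n∨m≡n (≤-pred k<1+a)
... | inj₁ k<a  = trans (cong ((k ∸ a) *_) (ff-vanish k<a)) (*-zeroʳ (k ∸ a))
... | inj₂ refl = cong (_* ff k k) (n∸n≡0 k)

ff-diag : ∀ k → ff k k ≡ k !
ff-diag zero    = refl
ff-diag (suc k) = trans (ff-suc-suc k k) (cong (suc k *_) (ff-diag k))

ff-pascal : ∀ k a → ff (suc k) (suc a) ≡ ff k (suc a) + suc a * ff k a
ff-pascal k a with a ≤? k
... | yes a≤k = begin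
  ff (suc k) (suc a)                        ≡⟨ ff-suc-suc k a ⟩
  suc k * ff k a                            ≡⟨ cong (_* ff k a) k+1≡[k∸a]+[a+1] ⟩
  ((k ∸ a) + suc a) * ff k a                ≡⟨ *-distribʳ-+ (ff k a) (k ∸ a) (suc a) ⟩
  (k ∸ a) * ff k a + suc a * ff k a         ∎
  where
  k+1≡[k∸a]+[a+1] : suc k ≡ (k ∸ a) + suc a
  k+1≡[k∸a]+[a+1] = sym (trans (+-comm (k ∸ a) (suc a)) (cong suc (m+[n∸m]≡n a≤k)))
... | no a≰k = begin
  ff (suc k) (suc a)                        ≡⟨ ff-suc-suc k a ⟩
  suc k * ff k a                            ≡⟨ cong (suc k *_) ffka≡0 ⟩
  suc k * 0                                 ≡⟨ *-zeroʳ (suc k) ⟩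
  0                                         ≡⟨ cong₂ _+_ (*-zeroʳ (k ∸ a)) (*-zeroʳ (suc a)) ⟨
  (k ∸ a) * 0 + suc a * 0                   ≡⟨ cong₂ (λ x y → (k ∸ a) * x + suc a * y) ffka≡0 ffka≡0 ⟨
  (k ∸ a) * ff k a + suc a * ff k a         ∎
  where
  ffka≡0 : ff k a ≡ 0
  ffka≡0 = ff-vanish (≰⇒> a≰k)

ff-pascal′ : ∀ q t → t * ff q (pred t) + ff q t ≡ ff (suc q) t
ff-pascal′ q zero    = refl
ff-pascal′ q (suc t) = trans (+-comm (suc t * ff q t) (ff q (suc t))) (sym (ff-pascal q t))

Σ<-C : ∀ c k → Σ< c (_C k) ≡ c C suc k
Σ<-C zero    k = sym (k>n⇒nCk≡0 {0} {suc k} (s≤s z≤n))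
Σ<-C (suc c) k = trans (cong (_+ c C k) (Σ<-C c k)) (trans (+-comm (c C suc k) (c C k)) (nCk+nC[k+1]≡[n+1]C[k+1] c k))

-- Ways to fill the last k positions of the left block when a values below m are still missing
-- (they may go anywhere) and the others are taken, in decreasing order, from c candidates;
-- if e ≠ 0, the value M − 1 is still missing and has to come first among the latter.
leftCount : ℕ → ℕ → ℕ → ℕ → ℕ
leftCount zero    a c k = (c C (k ∸ a)) * ff k a
leftCount (suc _) a c k = 𝟙 (a <? k) * ((c C (k ∸ suc a)) * ff k a)

C[1+k∸1+a]*ff : ∀ c k a → (c C suc (k ∸ suc a)) * ff k (suc a) ≡ (c C (k ∸ a)) * ff k (suc a)
C[1+k∸1+a]*ff c k a with a <? k
... | yes a<k = cong (λ i → (c C i) * ff k (suc a)) (sym (+-∸-assoc 1 a<k))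
... | no a≮k  = trans (cong ((c C suc (k ∸ suc a)) *_) ffk[1+a]≡0)
                (trans (*-zeroʳ (c C suc (k ∸ suc a)))
                (sym (trans (cong ((c C (k ∸ a)) *_) ffk[1+a]≡0) (*-zeroʳ (c C (k ∸ a))))))
  where
  ffk[1+a]≡0 : ff k (suc a) ≡ 0
  ffk[1+a]≡0 = ff-vanish (s≤s (≮⇒≥ a≮k))

-- First letter: one of the a small values, or the (j+1)-st smallest candidate, which leaves
-- the j candidates below it.
leftCount₀-suc : ∀ a c k → leftCount 0 a c (suc k) ≡ a * leftCount 0 (pred a) c k + Σ< c (λ j → leftCount 0 a j k)
leftCount₀-suc zero    c k = sym (trans (Σ<-cong c (λ j _ → *-identityʳ (j C k)))
                                        (trans (Σ<-C c k) (sym (*-identityʳ (c C suc k)))))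
leftCount₀-suc (suc a) c k = begin
  C[c] * ff (suc k) (suc a)                                    ≡⟨ cong (C[c] *_) (ff-pascal k a) ⟩
  C[c] * (ff k (suc a) + suc a * ff k a)                       ≡⟨ *-distribˡ-+ C[c] _ _ ⟩
  C[c] * ff k (suc a) + C[c] * (suc a * ff k a)                ≡⟨ +-comm (C[c] * ff k (suc a)) _ ⟩
  C[c] * (suc a * ff k a) + C[c] * ff k (suc a)                ≡⟨ cong₂ _+_ (*-x∙yz≈y∙xz C[c] (suc a) (ff k a))
                                                                            (sym (C[1+k∸1+a]*ff c k a)) ⟩
  suc a * (C[c] * ff k a) + (c C suc (k ∸ suc a)) * ff k (suc a) ≡⟨ cong (λ x → suc a * (C[c] * ff k a) + x * ff k (suc a))
                                                                         (Σ<-C c (k ∸ suc a)) ⟨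
  suc a * (C[c] * ff k a) + Σ< c (_C (k ∸ suc a)) * ff k (suc a)  ≡⟨ cong (suc a * (C[c] * ff k a) +_)
                                                                         (Σ<-*ʳ c (ff k (suc a)) (_C (k ∸ suc a))) ⟨
  suc a * (C[c] * ff k a) + Σ< c (λ j → (j C (k ∸ suc a)) * ff k (suc a)) ∎
  where
  C[c] : ℕ
  C[c] = c C (k ∸ a)

-- First letter when M − 1 is still due: a small value, or M − 1 itself.
leftCount₁-suc : ∀ a c k → leftCount 1 a c (suc k) ≡ a * leftCount 1 (pred a) c k + leftCount 0 a c k
leftCount₁-suc zero    c k = +-identityʳ ((c C k) * 1)
leftCount₁-suc (suc a) c k =
  trans (cong (_* (C[c] * ff (suc k) (suc a))) (𝟙-cong (suc a <? suc k) (a <? k) s<s⁻¹ s<s)) (by-cases (a <? k))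
  where
  C[c] : ℕ
  C[c] = c C (k ∸ suc a)
  by-cases : (d : Dec (a < k)) → 𝟙 d * (C[c] * ff (suc k) (suc a)) ≡ suc a * (𝟙 d * (C[c] * ff k a)) + C[c] * ff k (suc a)
  by-cases (yes a<k) = begin
    1 * (C[c] * ff (suc k) (suc a))                               ≡⟨ *-identityˡ _ ⟩
    C[c] * ff (suc k) (suc a)                                     ≡⟨ cong (C[c] *_) (ff-pascal k a) ⟩
    C[c] * (ff k (suc a) + suc a * ff k a)                        ≡⟨ *-distribˡ-+ C[c] _ _ ⟩
    C[c] * ff k (suc a) + C[c] * (suc a * ff k a)                 ≡⟨ +-comm (C[c] * ff k (suc a)) _ ⟩
    C[c] * (suc a * ff k a) + C[c] * ff k (suc a)                 ≡⟨ cong (_+ C[c] * ff k (suc a))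
                                                                           (*-x∙yz≈y∙xz C[c] (suc a) (ff k a)) ⟩
    suc a * (C[c] * ff k a) + C[c] * ff k (suc a)                 ≡⟨ cong (λ x → suc a * x + C[c] * ff k (suc a)) (*-identityˡ _) ⟨
    suc a * (1 * (C[c] * ff k a)) + C[c] * ff k (suc a)           ∎
  by-cases (no a≮k) = sym (cong₂ _+_ (*-zeroʳ (suc a)) (trans (cong (C[c] *_) (ff-vanish (s≤s (≮⇒≥ a≮k)))) (*-zeroʳ C[c])))

leftCount-cong : ∀ {e e′ a a′ c c′} k → e ≡ e′ → a ≡ a′ → c ≡ c′ → leftCount e a c k ≡ leftCount e′ a′ c′ k
leftCount-cong k refl refl refl = refl

leftCount-done : ∀ e a c → (e ≡ 0 × a ≡ 0) ⊎ leftCount e a c 0 ≡ 0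
leftCount-done zero    zero    c = inj₁ (refl , refl)
leftCount-done zero    (suc a) c = inj₂ (trans (cong (λ x → (c C 0) * (x * ff 0 a)) (0∸n≡0 a)) (*-zeroʳ (c C 0)))
leftCount-done (suc e) a       c = inj₂ (cong (_* ((c C (0 ∸ suc a)) * ff 0 a)) (𝟙-no (a <? 0) λ ()))

-- The automaton

Gap : ℕ → ℕ → Set
Gap m M = m ≡ M ⊎ 2 + m ≤ M

gap? : ∀ m M → Dec (Gap m M)
gap? m M = m ≟ M ⊎-dec 2 + m ≤? M

-- Reads a word letter by letter, the state being the list of values read so far, latest first.
-- It accepts exactly the words of K(r,n) whose least value right of position r is m and whose
-- largest value left of it is M − 1 (so m = M = r when the left block is {0,…,r−1}).
module Automaton (n r m M : ℕ) where

  unseen? : (pre : List ℕ) → Decidable (_∉ pre)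
  unseen? pre v = ¬? (v ∈? pre)

  Small : List ℕ → ℕ → Set
  Small pre v = v ∉ pre × v < m

  small? : ∀ pre → Decidable (Small pre)
  small? pre v = unseen? pre v ×-dec v <? m

  TopDue : List ℕ → Set
  TopDue pre = m < M × pred M ∉ pre

  topDue? : ∀ pre → Dec (TopDue pre)
  topDue? pre = m <? M ×-dec unseen? pre (pred M)

  Candidate : List ℕ → ℕ → Set
  Candidate pre v = v ∉ pre × m < v × suc v < M × All (λ z → m < z → v < z) pre

  candidate? : ∀ pre → Decidable (Candidate pre)
  candidate? pre v = unseen? pre v ×-dec m <? v ×-dec suc v <? M ×-dec all? (λ z → m <? z →-dec v <? z) pre

  Large : List ℕ → ℕ → Set
  Large pre v = v ∉ pre × M ≤ v

  large? : ∀ pre → Decidable (Large pre)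
  large? pre v = unseen? pre v ×-dec M ≤? v

  #unseen #small #candidates #large topDue : List ℕ → ℕ
  #unseen pre     = count n (unseen? pre)
  #small pre      = count m (unseen? pre)
  #candidates pre = count n (candidate? pre)
  #large pre      = count n (large? pre)
  topDue pre      = 𝟙 (topDue? pre)

  LeftStep : List ℕ → ℕ → Set
  LeftStep pre x = x ≢ m × x < M × (m < x → All (λ z → m < z → x < z) pre × (x ≡ pred M ⊎ pred M ∈ pre))

  leftStep? : ∀ pre → Decidable (LeftStep pre)
  leftStep? pre x =
    ¬? (x ≟ m) ×-dec x <? M ×-dec
    (m <? x →-dec (all? (λ z → m <? z →-dec x <? z) pre ×-dec (x ≟ pred M ⊎-dec pred M ∈? pre)))

  RightStep : List ℕ → ℕ → Set
  RightStep pre x = x < M → ∀ {y} → y < M → y ∉ pre → y ≤ x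

  rightStep? : ∀ pre → Decidable (RightStep pre)
  rightStep? pre x = x <? M →-dec allUpTo? (λ y → unseen? pre y →-dec y ≤? x) M

  Allowed : List ℕ → ℕ → Set
  Allowed pre x = x ∉ pre × (length pre < r → LeftStep pre x) × (r ≤ length pre → RightStep pre x)

  allowed? : ∀ pre → Decidable (Allowed pre)
  allowed? pre x = unseen? pre x ×-dec (length pre <? r →-dec leftStep? pre x) ×-dec (r ≤? length pre →-dec rightStep? pre x)

  -- Checked once the left block is complete; leftCount e a c 0 is 1 iff e = a = 0.
  gate : List ℕ → ℕ
  gate pre with length pre ≟ r
  ... | yes _ = leftCount (topDue pre) (#small pre) (#candidates pre) 0
  ... | no _  = 1

  accepts : ∀ {q} → List ℕ → Vec (Fin n) q → ℕ
  accepts pre []      = gate pre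
  accepts pre (x ∷ w) = gate pre * (𝟙 (allowed? pre (toℕ x)) * accepts (toℕ x ∷ pre) w)

  -- Right of r the unseen values below M must
  -- come in decreasing order, so the q free positions there can be filled in (q)_t ways,
  -- t = #large pre.
  completions : List ℕ → ℕ
  completions pre with length pre ≤? r
  ... | yes _ = leftCount (topDue pre) (#small pre) (#candidates pre) (r ∸ length pre) * ff (n ∸ r) (#large pre)
  ... | no _  = ff (n ∸ length pre) (#large pre)

  completions-left : ∀ pre → length pre ≤ r →
    completions pre ≡ leftCount (topDue pre) (#small pre) (#candidates pre) (r ∸ length pre) * ff (n ∸ r) (#large pre)
  completions-left pre len≤r with length pre ≤? r
  ... | yes _    = refl
  ... | no len≰r = contradiction len≤r len≰r

  completions-right : ∀ pre → r < length pre → completions pre ≡ ff (n ∸ length pre) (#large pre)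
  completions-right pre r<len with length pre ≤? r
  ... | yes len≤r = contradiction len≤r (<⇒≱ r<len)
  ... | no _      = refl

  gate-end : ∀ pre → length pre ≡ r → gate pre ≡ leftCount (topDue pre) (#small pre) (#candidates pre) 0
  gate-end pre len≡r with length pre ≟ r
  ... | yes _    = refl
  ... | no len≢r = contradiction len≡r len≢r

  gate-inside : ∀ pre → length pre ≢ r → gate pre ≡ 1
  gate-inside pre len≢r with length pre ≟ r
  ... | yes len≡r = contradiction len≡r len≢r
  ... | no _      = refl

  topDue≡0⊎1 : ∀ pre → topDue pre ≡ 0 ⊎ topDue pre ≡ 1
  topDue≡0⊎1 pre with topDue? pre
  ... | yes _ = inj₂ refl
  ... | no _  = inj₁ refl

  topDue≡0⇒top∈ : ∀ pre → topDue pre ≡ 0 → m < M → pred M ∈ pre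
  topDue≡0⇒top∈ pre topDue≡0 m<M =
    decidable-stable (pred M ∈? pre) (λ top∉ → 0≢1+n (trans (sym topDue≡0) (𝟙-yes (topDue? pre) (m<M , top∉))))

  #unseen-insert : ∀ pre x → x < n → x ∉ pre → suc (#unseen (x ∷ pre)) ≡ #unseen pre
  #unseen-insert pre x x<n x∉ =
    count-insert (unseen? (x ∷ pre)) (unseen? pre) n x x<n x∉ (λ _ _ → swap ∘ ∉-∷⁻) (λ _ _ v∉ v≢x → ∉-∷⁺ v≢x v∉)

  #small-insert : ∀ pre x → x < m → x ∉ pre → suc (#small (x ∷ pre)) ≡ #small pre
  #small-insert pre x x<m x∉ =
    count-insert (unseen? (x ∷ pre)) (unseen? pre) m x x<m x∉ (λ _ _ → swap ∘ ∉-∷⁻) (λ _ _ v∉ v≢x → ∉-∷⁺ v≢x v∉)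

  #small-insert-≥ : ∀ pre x → m ≤ x → #small (x ∷ pre) ≡ #small pre
  #small-insert-≥ pre x m≤x =
    count-cong (unseen? (x ∷ pre)) (unseen? pre) m
      (λ _ _ → proj₂ ∘ ∉-∷⁻) (λ v v<m → ∉-∷⁺ (λ { refl → <⇒≱ v<m m≤x }))

  #large-insert-< : ∀ pre x → x < M → #large (x ∷ pre) ≡ #large pre
  #large-insert-< pre x x<M = count-cong (large? (x ∷ pre)) (large? pre) n
    (λ _ _ (v∉ , M≤v) → proj₂ (∉-∷⁻ v∉) , M≤v)
    (λ _ _ (v∉ , M≤v) → ∉-∷⁺ (λ { refl → <⇒≱ x<M M≤v }) v∉ , M≤v)

  #large-insert : ∀ pre x → M ≤ x → x < n → x ∉ pre → suc (#large (x ∷ pre)) ≡ #large pre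
  #large-insert pre x M≤x x<n x∉ = count-insert (large? (x ∷ pre)) (large? pre) n x x<n (x∉ , M≤x)
    (λ _ _ (v∉ , M≤v) → (proj₂ (∉-∷⁻ v∉) , M≤v) , proj₁ (∉-∷⁻ v∉))
    (λ _ _ (v∉ , M≤v) v≢x → ∉-∷⁺ v≢x v∉ , M≤v)

  topDue-insert : ∀ pre x → x ≢ pred M → topDue (x ∷ pre) ≡ topDue pre
  topDue-insert pre x x≢top = 𝟙-cong (topDue? (x ∷ pre)) (topDue? pre)
    (λ (m<M , top∉) → m<M , proj₂ (∉-∷⁻ top∉)) (λ (m<M , top∉) → m<M , ∉-∷⁺ (x≢top ∘ sym) top∉)

  topDue-insert-top : ∀ pre → topDue (pred M ∷ pre) ≡ 0
  topDue-insert-top pre = 𝟙-no (topDue? (pred M ∷ pre)) (λ (_ , top∉) → top∉ (here refl))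

  topDue-insert-small : ∀ pre x → x < m → topDue (x ∷ pre) ≡ topDue pre
  topDue-insert-small pre x x<m with x ≟ pred M
  ... | no x≢top  = topDue-insert pre x x≢top
  ... | yes refl = trans (𝟙-no (topDue? (x ∷ pre)) top≤x) (sym (𝟙-no (topDue? pre) top≤x))
    where
    top≤x : ∀ {A : Set} → ¬ (m < M × A)
    top≤x (m<M , _) = <⇒≱ x<m (<⇒≤pred m<M)

  #candidates-insert-≤ : ∀ pre x → x ≤ m → #candidates (x ∷ pre) ≡ #candidates pre
  #candidates-insert-≤ pre x x≤m = count-cong (candidate? (x ∷ pre)) (candidate? pre) n
    (λ { _ _ (v∉ , m<v , v+1<M , _ ∷ below) → proj₂ (∉-∷⁻ v∉) , m<v , v+1<M , below })
    (λ _ _ (v∉ , m<v , v+1<M , below) →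
      ∉-∷⁺ (λ { refl → <⇒≱ m<v x≤m }) v∉ , m<v , v+1<M , (λ m<x → contradiction x≤m (<⇒≱ m<x)) ∷ below)

  #candidates-insert-top : ∀ pre → #candidates (pred M ∷ pre) ≡ #candidates pre
  #candidates-insert-top pre = count-cong (candidate? (pred M ∷ pre)) (candidate? pre) n
    (λ { _ _ (v∉ , m<v , v+1<M , _ ∷ below) → proj₂ (∉-∷⁻ v∉) , m<v , v+1<M , below })
    (λ v _ (v∉ , m<v , v+1<M , below) →
      ∉-∷⁺ (<⇒≢ (suc<⇒<pred v+1<M)) v∉ , m<v , v+1<M , (λ _ → suc<⇒<pred v+1<M) ∷ below)

  -- Reading a candidate x discards every candidate above it.
  #candidates-insert-candidate : ∀ pre x → x < n → Candidate pre x → #candidates (x ∷ pre) ≡ count x (candidate? pre)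
  #candidates-insert-candidate pre x x<n (x∉ , m<x , _ , _) = begin
    #candidates (x ∷ pre)                            ≡⟨ count-cong (candidate? (x ∷ pre)) candidate<x? n
                                                         (λ { _ _ (v∉ , m<v , v+1<M , v<x ∷ below) →
                                                                (proj₂ (∉-∷⁻ v∉) , m<v , v+1<M , below) , v<x m<x })
                                                         (λ _ _ ((v∉ , m<v , v+1<M , below) , v<x) →
                                                                ∉-∷⁺ (<⇒≢ v<x) v∉ , m<v , v+1<M , (λ _ → v<x) ∷ below) ⟩
    count n candidate<x?                             ≡⟨ Σ<-truncate x n (<⇒≤ x<n)
                                                         (λ v x≤v _ → 𝟙-no (candidate<x? v) (λ (_ , v<x) → <⇒≱ v<x x≤v)) ⟩
    count x candidate<x?                             ≡⟨ count-cong candidate<x? (candidate? pre) x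
                                                         (λ _ _ → proj₁) (λ _ v<x c → c , v<x) ⟩
    count x (candidate? pre)                         ∎
    where
    candidate<x? : Decidable (λ v → Candidate pre v × v < x)
    candidate<x? v = candidate? pre v ×-dec v <? x

  -- While M − 1 is due, no value above m has been read: M − 1 must be the first of them.
  Invariant : List ℕ → Set
  Invariant pre = #unseen pre + length pre ≡ n × (length pre ≤ r → topDue pre ≡ 1 → All (m ≮_) pre)

  Invariant-[] : Invariant []
  Invariant-[] = trans (+-identityʳ _) (trans (Σ<-const n 1) (*-identityʳ n)) , λ _ _ → []

  Invariant-step : ∀ pre x → x < n → Invariant pre → Allowed pre x → Invariant (x ∷ pre)
  Invariant-step pre x x<n (#unseen+len≡n , noLarge) (x∉ , left , _) =
    trans (+-suc (#unseen (x ∷ pre)) (length pre))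
          (trans (cong (_+ length pre) (#unseen-insert pre x x<n x∉)) #unseen+len≡n) ,
    noLarge′
    where
    noLarge′ : suc (length pre) ≤ r → topDue (x ∷ pre) ≡ 1 → All (m ≮_) (x ∷ pre)
    noLarge′ len<r due with x <? m | left len<r
    ... | yes x<m | _ = <⇒≯ x<m ∷ noLarge (<⇒≤ len<r) (trans (sym (topDue-insert-small pre x x<m)) due)
    ... | no x≮m | (x≢m , _ , above) with proj₂ (above (≮∧≢⇒> x≮m x≢m))
    ...   | inj₁ refl = contradiction (trans (sym (topDue-insert-top pre)) due) 0≢1+n
    ...   | inj₂ top∈ = contradiction (trans (sym (𝟙-no (topDue? (x ∷ pre)) (λ (_ , top∉) → top∉ (there top∈)))) due) 0≢1+n

  module Counting (r≤n : r ≤ n) (m≤n : m ≤ n) (M≤n : M ≤ n) (gap : Gap m M) where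

    m≤M : m ≤ M
    m≤M = [ ≤-reflexive , (λ 2+m≤M → <⇒≤ (≤-trans (n≤1+n (suc m)) 2+m≤M)) ]′ gap

    topDue≡1⇒ : ∀ pre → topDue pre ≡ 1 → m < pred M × pred M ∉ pre
    topDue≡1⇒ pre due with m<M , top∉ ← 𝟙≡1⇒ (topDue? pre) due =
      [ (λ m≡M → contradiction m<M (<-irrefl m≡M)) , suc<⇒<pred ]′ gap , top∉

    leftAllowed : ∀ pre x → length pre < r → x ∉ pre → LeftStep pre x → Allowed pre x
    leftAllowed pre x len<r x∉ step = x∉ , (λ _ → step) , (λ r≤len → contradiction len<r (≤⇒≯ r≤len))

    small⇒allowed : ∀ pre x → length pre < r → Small pre x → Allowed pre x
    small⇒allowed pre x len<r (x∉ , x<m) =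
      leftAllowed pre x len<r x∉ (<⇒≢ x<m , <-≤-trans x<m m≤M , λ m<x → contradiction x<m (<⇒≯ m<x))

    allowed-left-topDue : ∀ pre → Invariant pre → length pre < r → topDue pre ≡ 1 →
                          ∀ x → 𝟙 (allowed? pre x) ≡ 𝟙 (small? pre x) + 𝟙 (x ≟ pred M)
    allowed-left-topDue pre (_ , noLarge) len<r due x =
      𝟙-⊎ (allowed? pre x) (small? pre x) (x ≟ pred M) split (small⇒allowed pre x len<r) top⇒allowed
          (λ (_ , x<m) x≡top → <⇒≢ (<-trans x<m m<top) x≡top)
      where
      m<top : m < pred M
      m<top = proj₁ (topDue≡1⇒ pre due)
      top∉ : pred M ∉ pre
      top∉ = proj₂ (topDue≡1⇒ pre due)
      split : Allowed pre x → Small pre x ⊎ x ≡ pred M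
      split (x∉ , left , _) with x <? m | left len<r
      ... | yes x<m | _                  = inj₁ (x∉ , x<m)
      ... | no x≮m  | (x≢m , _ , above) =
        [ inj₂ , (λ top∈ → contradiction top∈ top∉) ]′ (proj₂ (above (≮∧≢⇒> x≮m x≢m)))
      top⇒allowed : x ≡ pred M → Allowed pre x
      top⇒allowed refl = leftAllowed pre x len<r top∉
        ( (<⇒≢ m<top) ∘ sym , pred< m<top
        , λ _ → All.map (λ m≮z m<z → contradiction m<z m≮z) (noLarge (<⇒≤ len<r) due) , inj₁ refl)

    allowed-left-topDone : ∀ pre → length pre < r → topDue pre ≡ 0 →
                           ∀ x → 𝟙 (allowed? pre x) ≡ 𝟙 (small? pre x) + 𝟙 (candidate? pre x)
    allowed-left-topDone pre len<r done x =
      𝟙-⊎ (allowed? pre x) (small? pre x) (candidate? pre x) split (small⇒allowed pre x len<r) candidate⇒allowed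
          (λ (_ , x<m) (_ , m<x , _) → <-asym x<m m<x)
      where
      split : Allowed pre x → Small pre x ⊎ Candidate pre x
      split (x∉ , left , _) with x <? m | left len<r
      ... | yes x<m | _                  = inj₁ (x∉ , x<m)
      ... | no x≮m  | (x≢m , x<M , above) with above (≮∧≢⇒> x≮m x≢m)
      ...   | _     , inj₁ refl = contradiction (topDue≡0⇒top∈ pre done (<-trans (≮∧≢⇒> x≮m x≢m) x<M)) x∉
      ...   | below , inj₂ top∈ = inj₂ (x∉ , ≮∧≢⇒> x≮m x≢m , <∧≢pred⇒suc< x<M (λ { refl → x∉ top∈ }) , below)
      candidate⇒allowed : Candidate pre x → Allowed pre x
      candidate⇒allowed (x∉ , m<x , x+1<M , below) = leftAllowed pre x len<r x∉
        ((<⇒≢ m<x) ∘ sym , x<M , λ _ → below , inj₂ (topDue≡0⇒top∈ pre done (<-trans m<x x<M)))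
        where
        x<M : x < M
        x<M = <-trans (n<1+n x) x+1<M

    leftCountAfter : List ℕ → ℕ → ℕ → ℕ
    leftCountAfter pre k x = leftCount (topDue (x ∷ pre)) (#small (x ∷ pre)) (#candidates (x ∷ pre)) k

    Σ-small : ∀ pre k → Σ< n (λ x → 𝟙 (small? pre x) * leftCountAfter pre k x)
                        ≡ #small pre * leftCount (topDue pre) (pred (#small pre)) (#candidates pre) k
    Σ-small pre k =
      trans (Σ<-𝟙*-const (small? pre) n (leftCountAfter pre k) afterSmall (λ x _ (x∉ , x<m) →
               leftCount-cong k (topDue-insert-small pre x x<m) (cong pred (#small-insert pre x x<m x∉))
                                (#candidates-insert-≤ pre x (<⇒≤ x<m))))
            (cong (_* afterSmall) count-small)
      where
      afterSmall : ℕ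
      afterSmall = leftCount (topDue pre) (pred (#small pre)) (#candidates pre) k
      count-small : count n (small? pre) ≡ #small pre
      count-small = trans (Σ<-truncate m n m≤n (λ v m≤v _ → 𝟙-no (small? pre v) (λ (_ , v<m) → <⇒≱ v<m m≤v)))
                          (count-cong (small? pre) (unseen? pre) m (λ _ _ → proj₁) (λ _ v<m v∉ → v∉ , v<m))

    Σ-top : ∀ pre k → topDue pre ≡ 1 →
            Σ< n (λ x → 𝟙 (x ≟ pred M) * leftCountAfter pre k x) ≡ leftCount 0 (#small pre) (#candidates pre) k
    Σ-top pre k due = begin
      Σ< n (λ x → 𝟙 (x ≟ pred M) * leftCountAfter pre k x)   ≡⟨ Σ<-single n (pred M) top<n
                                                                  (λ v _ v≢top → cong (_* leftCountAfter pre k v)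
                                                                                      (𝟙-no (v ≟ pred M) v≢top)) ⟩
      𝟙 (pred M ≟ pred M) * leftCountAfter pre k (pred M)     ≡⟨ cong (_* leftCountAfter pre k (pred M))
                                                                      (𝟙-yes (pred M ≟ pred M) refl) ⟩
      1 * leftCountAfter pre k (pred M)                       ≡⟨ *-identityˡ _ ⟩
      leftCountAfter pre k (pred M)                           ≡⟨ leftCount-cong k (topDue-insert-top pre)
                                                                  (#small-insert-≥ pre (pred M) (<⇒≤ m<top))
                                                                  (#candidates-insert-top pre) ⟩
      leftCount 0 (#small pre) (#candidates pre) k            ∎
      where
      m<top : m < pred M
      m<top = proj₁ (topDue≡1⇒ pre due)
      top<n : pred M < n
      top<n = <-≤-trans (pred< m<top) M≤n

    Σ-candidate : ∀ pre k → topDue pre ≡ 0 →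
                  Σ< n (λ x → 𝟙 (candidate? pre x) * leftCountAfter pre k x)
                  ≡ Σ< (#candidates pre) (λ j → leftCount 0 (#small pre) j k)
    Σ-candidate pre k done =
      trans (Σ<-cong n (λ x x<n → 𝟙*-cong (candidate? pre x) (λ cand@(_ , m<x , x+1<M , _) →
               leftCount-cong k (trans (topDue-insert pre x (<⇒≢ (suc<⇒<pred x+1<M))) done)
                                (#small-insert-≥ pre x (<⇒≤ m<x))
                                (#candidates-insert-candidate pre x x<n cand))))
            (Σ<-rank (candidate? pre) n (λ j → leftCount 0 (#small pre) j k))

    Σ-leftStep : ∀ pre → Invariant pre → length pre < r → ∀ k →
                 Σ< n (λ x → 𝟙 (allowed? pre x) * leftCountAfter pre k x)
                 ≡ leftCount (topDue pre) (#small pre) (#candidates pre) (suc k)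
    Σ-leftStep pre inv len<r k with topDue≡0⊎1 pre
    ... | inj₁ done = begin
      Σ< n (λ x → 𝟙 (allowed? pre x) * leftCountAfter pre k x)
        ≡⟨ Σ<-𝟙-split (allowed? pre) (small? pre) (candidate? pre) n _ (allowed-left-topDone pre len<r done) ⟩
      Σ< n (λ x → 𝟙 (small? pre x) * leftCountAfter pre k x) + Σ< n (λ x → 𝟙 (candidate? pre x) * leftCountAfter pre k x)
        ≡⟨ cong₂ _+_ (Σ-small pre k) (Σ-candidate pre k done) ⟩
      #small pre * leftCount (topDue pre) (pred (#small pre)) (#candidates pre) k + Σ< (#candidates pre) (λ j → leftCount 0 (#small pre) j k)
        ≡⟨ cong (λ e → #small pre * leftCount e (pred (#small pre)) (#candidates pre) k
                       + Σ< (#candidates pre) (λ j → leftCount 0 (#small pre) j k)) done ⟩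
      #small pre * leftCount 0 (pred (#small pre)) (#candidates pre) k + Σ< (#candidates pre) (λ j → leftCount 0 (#small pre) j k)
        ≡⟨ leftCount₀-suc (#small pre) (#candidates pre) k ⟨
      leftCount 0 (#small pre) (#candidates pre) (suc k)
        ≡⟨ cong (λ e → leftCount e (#small pre) (#candidates pre) (suc k)) done ⟨
      leftCount (topDue pre) (#small pre) (#candidates pre) (suc k) ∎
    ... | inj₂ due = begin
      Σ< n (λ x → 𝟙 (allowed? pre x) * leftCountAfter pre k x)
        ≡⟨ Σ<-𝟙-split (allowed? pre) (small? pre) (_≟ pred M) n _ (allowed-left-topDue pre inv len<r due) ⟩
      Σ< n (λ x → 𝟙 (small? pre x) * leftCountAfter pre k x) + Σ< n (λ x → 𝟙 (x ≟ pred M) * leftCountAfter pre k x)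
        ≡⟨ cong₂ _+_ (Σ-small pre k) (Σ-top pre k due) ⟩
      #small pre * leftCount (topDue pre) (pred (#small pre)) (#candidates pre) k + leftCount 0 (#small pre) (#candidates pre) k
        ≡⟨ cong (λ e → #small pre * leftCount e (pred (#small pre)) (#candidates pre) k
                       + leftCount 0 (#small pre) (#candidates pre) k) due ⟩
      #small pre * leftCount 1 (pred (#small pre)) (#candidates pre) k + leftCount 0 (#small pre) (#candidates pre) k
        ≡⟨ leftCount₁-suc (#small pre) (#candidates pre) k ⟨
      leftCount 1 (#small pre) (#candidates pre) (suc k)
        ≡⟨ cong (λ e → leftCount e (#small pre) (#candidates pre) (suc k)) due ⟨
      leftCount (topDue pre) (#small pre) (#candidates pre) (suc k) ∎

    allowed-right : ∀ pre → r ≤ length pre →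
                    ∀ x → 𝟙 (allowed? pre x) ≡ 𝟙 (large? pre x) + 𝟙 (isMaxBelow? (unseen? pre) M x)
    allowed-right pre r≤len x = 𝟙-⊎ (allowed? pre x) (large? pre x) (isMaxBelow? (unseen? pre) M x) split
      (λ (x∉ , M≤x) → x∉ , notLeft , λ _ x<M → contradiction M≤x (<⇒≱ x<M))
      (λ (x∉ , _ , max) → x∉ , notLeft , λ _ _ → max)
      (λ (_ , M≤x) (_ , x<M , _) → <⇒≱ x<M M≤x)
      where
      notLeft : ∀ {A : Set} → length pre < r → A
      notLeft len<r = contradiction r≤len (<⇒≱ len<r)
      split : Allowed pre x → Large pre x ⊎ IsMaxBelow (unseen? pre) M x
      split (x∉ , _ , right) with M ≤? x
      ... | yes M≤x = inj₁ (x∉ , M≤x)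
      ... | no M≰x  = inj₂ (x∉ , ≰⇒> M≰x , right r≤len (≰⇒> M≰x))

    -- If no value below M is left, the unseen values are exactly the large ones, so t = q + 1
    -- and (q)_t = 0 absorbs the missing term.
    Σ-rightStep : ∀ pre q → #unseen pre ≡ suc q → r ≤ length pre →
                  Σ< n (λ x → 𝟙 (allowed? pre x) * ff q (#large (x ∷ pre))) ≡ ff (suc q) (#large pre)
    Σ-rightStep pre q #unseen≡1+q r≤len = begin
      Σ< n (λ x → 𝟙 (allowed? pre x) * ff q (#large (x ∷ pre)))
        ≡⟨ Σ<-𝟙-split (allowed? pre) (large? pre) (isMaxBelow? (unseen? pre) M) n _ (allowed-right pre r≤len) ⟩
      Σ< n (λ x → 𝟙 (large? pre x) * ff q (#large (x ∷ pre)))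
      + Σ< n (λ x → 𝟙 (isMaxBelow? (unseen? pre) M x) * ff q (#large (x ∷ pre)))
        ≡⟨ cong₂ _+_ (Σ<-𝟙*-const (large? pre) n _ _ (λ x x<n (x∉ , M≤x) →
                                                           cong (ff q ∘ pred) (#large-insert pre x M≤x x<n x∉)))
                     (Σ<-𝟙*-const (isMaxBelow? (unseen? pre) M) n _ _ (λ x _ (_ , x<M , _) → cong (ff q) (#large-insert-< pre x x<M))) ⟩
      #large pre * ff q (pred (#large pre)) + count n (isMaxBelow? (unseen? pre) M) * ff q (#large pre)
        ≡⟨ cong (λ c → #large pre * ff q (pred (#large pre)) + c) (by-cases (anyUpTo? (unseen? pre) M)) ⟩
      #large pre * ff q (pred (#large pre)) + ff q (#large pre)
        ≡⟨ ff-pascal′ q (#large pre) ⟩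
      ff (suc q) (#large pre) ∎
      where
      by-cases : Dec (∃ λ y → y < M × y ∉ pre) → count n (isMaxBelow? (unseen? pre) M) * ff q (#large pre) ≡ ff q (#large pre)
      by-cases (yes ∃y) = trans (cong (_* ff q (#large pre)) (count-isMaxBelow (unseen? pre) M n M≤n ∃y)) (*-identityˡ _)
      by-cases (no ∄y)  = trans (cong (_* ff q (#large pre))
                                      (count-isMaxBelow-none (unseen? pre) M n (λ y y<M y∉ → ∄y (y , y<M , y∉))))
                                (sym (trans (cong (ff q) #large≡1+q) (ff-vanish (n<1+n q))))
        where
        #large≡1+q : #large pre ≡ suc q
        #large≡1+q = trans (count-cong (large? pre) (unseen? pre) n (λ _ _ → proj₁)
                                       (λ v _ v∉ → v∉ , ≮⇒≥ (λ v<M → ∄y (v , v<M , v∉))))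
                           #unseen≡1+q

    completions-step-left : ∀ pre → Invariant pre → length pre < r →
                            Σ< n (λ x → 𝟙 (allowed? pre x) * completions (x ∷ pre)) ≡ completions pre
    completions-step-left pre inv len<r = begin
      Σ< n (λ x → 𝟙 (allowed? pre x) * completions (x ∷ pre))
        ≡⟨ Σ<-cong n (λ x _ → completions-after x) ⟩
      Σ< n (λ x → 𝟙 (allowed? pre x) * leftCountAfter pre k′ x * rightCount)
        ≡⟨ Σ<-*ʳ n rightCount _ ⟩
      Σ< n (λ x → 𝟙 (allowed? pre x) * leftCountAfter pre k′ x) * rightCount
        ≡⟨ cong (_* rightCount) (Σ-leftStep pre inv len<r k′) ⟩
      leftCount (topDue pre) (#small pre) (#candidates pre) (suc k′) * rightCount
        ≡⟨ cong (λ i → leftCount (topDue pre) (#small pre) (#candidates pre) i * rightCount) (+-∸-assoc 1 len<r) ⟨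
      leftCount (topDue pre) (#small pre) (#candidates pre) (r ∸ length pre) * rightCount
        ≡⟨ completions-left pre (<⇒≤ len<r) ⟨
      completions pre ∎
      where
      k′ rightCount : ℕ
      k′ = r ∸ suc (length pre)
      rightCount = ff (n ∸ r) (#large pre)
      completions-after : ∀ x → 𝟙 (allowed? pre x) * completions (x ∷ pre)
                                ≡ 𝟙 (allowed? pre x) * leftCountAfter pre k′ x * rightCount
      completions-after x = trans (𝟙*-cong (allowed? pre x) (λ (_ , left , _) →
        trans (completions-left (x ∷ pre) len<r)
              (cong (λ t → leftCountAfter pre k′ x * ff (n ∸ r) t) (#large-insert-< pre x (proj₁ (proj₂ (left len<r)))))))
        (sym (*-assoc (𝟙 (allowed? pre x)) _ _))

    completions-step-right : ∀ pre q → length pre + suc q ≡ n → Invariant pre → r ≤ length pre →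
                             gate pre * Σ< n (λ x → 𝟙 (allowed? pre x) * completions (x ∷ pre)) ≡ completions pre
    completions-step-right pre q len+q+1≡n (#unseen+len≡n , _) r≤len = begin
      gate pre * Σ< n (λ x → 𝟙 (allowed? pre x) * completions (x ∷ pre))
        ≡⟨ cong (gate pre *_) (Σ<-cong n (λ x _ → 𝟙*-cong (allowed? pre x) (λ _ →
             trans (completions-right (x ∷ pre) (s≤s r≤len)) (cong (λ i → ff i (#large (x ∷ pre))) n∸[1+len]≡q)))) ⟩
      gate pre * Σ< n (λ x → 𝟙 (allowed? pre x) * ff q (#large (x ∷ pre)))
        ≡⟨ cong (gate pre *_) (Σ-rightStep pre q #unseen≡1+q r≤len) ⟩
      gate pre * ff (suc q) (#large pre)
        ≡⟨ by-cases (length pre ≟ r) ⟩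
      completions pre ∎
      where
      n∸len≡1+q : n ∸ length pre ≡ suc q
      n∸len≡1+q = trans (cong (_∸ length pre) (sym len+q+1≡n)) (m+n∸m≡n (length pre) (suc q))
      n∸[1+len]≡q : n ∸ suc (length pre) ≡ q
      n∸[1+len]≡q = trans (sym (pred[m∸n]≡m∸[1+n] n (length pre))) (cong pred n∸len≡1+q)
      #unseen≡1+q : #unseen pre ≡ suc q
      #unseen≡1+q = trans (sym (m+n∸n≡m (#unseen pre) (length pre))) (trans (cong (_∸ length pre) #unseen+len≡n) n∸len≡1+q)
      by-cases : Dec (length pre ≡ r) → gate pre * ff (suc q) (#large pre) ≡ completions pre
      by-cases (yes len≡r) = begin
        gate pre * ff (suc q) (#large pre)
          ≡⟨ cong₂ _*_ (gate-end pre len≡r) (cong (λ i → ff i (#large pre)) (trans (sym n∸len≡1+q) (cong (n ∸_) len≡r))) ⟩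
        leftCount (topDue pre) (#small pre) (#candidates pre) 0 * ff (n ∸ r) (#large pre)
          ≡⟨ cong (λ i → leftCount (topDue pre) (#small pre) (#candidates pre) i * ff (n ∸ r) (#large pre))
                  (trans (cong (r ∸_) len≡r) (n∸n≡0 r)) ⟨
        leftCount (topDue pre) (#small pre) (#candidates pre) (r ∸ length pre) * ff (n ∸ r) (#large pre)
          ≡⟨ completions-left pre (≤-reflexive len≡r) ⟨
        completions pre ∎
      by-cases (no len≢r) = begin
        gate pre * ff (suc q) (#large pre)      ≡⟨ cong₂ _*_ (gate-inside pre len≢r)
                                                             (cong (λ i → ff i (#large pre)) (sym n∸len≡1+q)) ⟩
        1 * ff (n ∸ length pre) (#large pre)    ≡⟨ *-identityˡ _ ⟩
        ff (n ∸ length pre) (#large pre)        ≡⟨ completions-right pre (≤∧≢⇒< r≤len (len≢r ∘ sym)) ⟨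
        completions pre                         ∎

    completions-step : ∀ pre q → length pre + suc q ≡ n → Invariant pre →
                       gate pre * Σ< n (λ x → 𝟙 (allowed? pre x) * completions (x ∷ pre)) ≡ completions pre
    completions-step pre q len+q+1≡n inv = by-cases (length pre <? r)
      where
      by-cases : Dec (length pre < r) → gate pre * Σ< n (λ x → 𝟙 (allowed? pre x) * completions (x ∷ pre)) ≡ completions pre
      by-cases (yes len<r) =
        trans (cong (_* Σ< n (λ x → 𝟙 (allowed? pre x) * completions (x ∷ pre))) (gate-inside pre (<⇒≢ len<r)))
              (trans (*-identityˡ _) (completions-step-left pre inv len<r))
      by-cases (no len≮r) = completions-step-right pre q len+q+1≡n inv (≮⇒≥ len≮r)

    completions-final : ∀ pre → length pre ≡ n → Invariant pre → gate pre ≡ completions pre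
    completions-final pre len≡n (#unseen+len≡n , _) = by-cases (length pre ≟ r)
      where
      #large≡0 : #large pre ≡ 0
      #large≡0 = n≤0⇒n≡0 (≤-trans (Σ<-mono-≤ n (λ v _ → 𝟙-mono (large? pre v) (unseen? pre v) proj₁))
                                  (≤-reflexive (+-cancelʳ-≡ (length pre) (#unseen pre) 0 (trans #unseen+len≡n (sym len≡n)))))
      by-cases : Dec (length pre ≡ r) → gate pre ≡ completions pre
      by-cases (yes len≡r) = trans (gate-end pre len≡r) (sym (begin
        completions pre
          ≡⟨ completions-left pre (≤-reflexive len≡r) ⟩
        leftCount (topDue pre) (#small pre) (#candidates pre) (r ∸ length pre) * ff (n ∸ r) (#large pre)
          ≡⟨ cong₂ (λ i t → leftCount (topDue pre) (#small pre) (#candidates pre) i * ff (n ∸ r) t)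
                   (trans (cong (r ∸_) len≡r) (n∸n≡0 r)) #large≡0 ⟩
        leftCount (topDue pre) (#small pre) (#candidates pre) 0 * 1
          ≡⟨ *-identityʳ _ ⟩
        leftCount (topDue pre) (#small pre) (#candidates pre) 0 ∎))
      by-cases (no len≢r) =
        trans (gate-inside pre len≢r) (sym (trans (completions-right pre r<len) (cong (ff (n ∸ length pre)) #large≡0)))
        where
        r<len : r < length pre
        r<len = ≤∧≢⇒< (subst (r ≤_) (sym len≡n) r≤n) (len≢r ∘ sym)

    Σ-accepts : ∀ q pre → length pre + q ≡ n → Invariant pre →
                Σᴸ (accepts pre) (allWords (allFin n) q) ≡ completions pre
    Σ-accepts zero    pre len+0≡n inv =
      trans (+-identityʳ (gate pre)) (completions-final pre (trans (sym (+-identityʳ _)) len+0≡n) inv)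
    Σ-accepts (suc q) pre len+q+1≡n inv = begin
      Σᴸ (accepts pre) (allWords (allFin n) (suc q))
        ≡⟨ Σᴸ-allWords-suc (allFin n) q (accepts pre) ⟩
      Σᴸ (λ x → Σᴸ (λ w → gate pre * (𝟙 (allowed? pre (toℕ x)) * accepts (toℕ x ∷ pre) w)) words) (allFin n)
        ≡⟨ Σᴸ-cong (allFin n) first-letter ⟩
      Σᴸ (λ x → gate pre * (𝟙 (allowed? pre (toℕ x)) * completions (toℕ x ∷ pre))) (allFin n)
        ≡⟨ Σᴸ-allFin n (λ v → gate pre * (𝟙 (allowed? pre v) * completions (v ∷ pre))) ⟩
      Σ< n (λ v → gate pre * (𝟙 (allowed? pre v) * completions (v ∷ pre)))
        ≡⟨ Σ<-*ˡ n (gate pre) _ ⟩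
      gate pre * Σ< n (λ v → 𝟙 (allowed? pre v) * completions (v ∷ pre))
        ≡⟨ completions-step pre q len+q+1≡n inv ⟩
      completions pre ∎
      where
      words : List (Vec (Fin n) q)
      words = allWords (allFin n) q
      first-letter : ∀ x → Σᴸ (λ w → gate pre * (𝟙 (allowed? pre (toℕ x)) * accepts (toℕ x ∷ pre) w)) words
                           ≡ gate pre * (𝟙 (allowed? pre (toℕ x)) * completions (toℕ x ∷ pre))
      first-letter x =
        trans (Σᴸ-*ˡ (gate pre) _ words)
              (cong (gate pre *_) (trans (Σᴸ-*ˡ (𝟙 (allowed? pre (toℕ x))) _ words)
                                         (𝟙*-cong (allowed? pre (toℕ x)) (λ allowed →
                                           Σ-accepts q (toℕ x ∷ pre) (trans (sym (+-suc (length pre) q)) len+q+1≡n)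
                                                     (Invariant-step pre (toℕ x) (toℕ<n x) inv allowed)))))

  stateAfter : ∀ {q} → List ℕ → Vec (Fin n) q → ℕ → List ℕ
  stateAfter pre w       zero    = pre
  stateAfter pre []      (suc k) = pre
  stateAfter pre (x ∷ w) (suc k) = stateAfter (toℕ x ∷ pre) w k

  length-stateAfter : ∀ {q} pre (w : Vec (Fin n) q) k → k ≤ q → length (stateAfter pre w k) ≡ length pre + k
  length-stateAfter pre w       zero    _         = sym (+-identityʳ _)
  length-stateAfter pre (x ∷ w) (suc k) (s≤s k≤q) = trans (length-stateAfter (toℕ x ∷ pre) w k k≤q) (sym (+-suc (length pre) k))

  ∈-stateAfter⁻ : ∀ {q} pre (w : Vec (Fin n) q) k {v} → v ∈ stateAfter pre w k →
                  v ∈ pre ⊎ ∃ λ j → toℕ j < k × toℕ (lookup w j) ≡ v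
  ∈-stateAfter⁻ pre w       zero    v∈ = inj₁ v∈
  ∈-stateAfter⁻ pre []      (suc k) v∈ = inj₁ v∈
  ∈-stateAfter⁻ pre (x ∷ w) (suc k) v∈ with ∈-stateAfter⁻ (toℕ x ∷ pre) w k v∈
  ... | inj₁ (here v≡x)             = inj₂ (Fin.zero , s≤s z≤n , sym v≡x)
  ... | inj₁ (there v∈pre)          = inj₁ v∈pre
  ... | inj₂ (j , j<k , wj≡v)       = inj₂ (Fin.suc j , s≤s j<k , wj≡v)

  ∈-stateAfter-pre : ∀ {q} pre (w : Vec (Fin n) q) k {v} → v ∈ pre → v ∈ stateAfter pre w k
  ∈-stateAfter-pre pre w       zero    v∈ = v∈
  ∈-stateAfter-pre pre []      (suc k) v∈ = v∈
  ∈-stateAfter-pre pre (x ∷ w) (suc k) v∈ = ∈-stateAfter-pre (toℕ x ∷ pre) w k (there v∈)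

  ∈-stateAfter⁺ : ∀ {q} pre (w : Vec (Fin n) q) k (j : Fin q) → toℕ j < k → toℕ (lookup w j) ∈ stateAfter pre w k
  ∈-stateAfter⁺ pre (x ∷ w) (suc k) Fin.zero    _         = ∈-stateAfter-pre (toℕ x ∷ pre) w k (here refl)
  ∈-stateAfter⁺ pre (x ∷ w) (suc k) (Fin.suc j) (s≤s j<k) = ∈-stateAfter⁺ (toℕ x ∷ pre) w k j j<k

  Accepting : ∀ {q} → List ℕ → Vec (Fin n) q → Set
  Accepting {q} pre w = (∀ (i : Fin q) → Allowed (stateAfter pre w (toℕ i)) (toℕ (lookup w i)))
                      × (∀ k → k ≤ q → gate (stateAfter pre w k) ≡ 1)

  gate≡0⊎1 : ∀ pre → gate pre ≡ 0 ⊎ gate pre ≡ 1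
  gate≡0⊎1 pre with length pre ≟ r
  ... | no _  = inj₂ refl
  ... | yes _ with leftCount-done (topDue pre) (#small pre) (#candidates pre)
  ...   | inj₁ (e≡0 , a≡0) = inj₂ (leftCount-cong 0 e≡0 a≡0 refl)
  ...   | inj₂ ≡0          = inj₁ ≡0

  accepts≡0⊎1 : ∀ {q} pre (w : Vec (Fin n) q) → accepts pre w ≡ 0 ⊎ accepts pre w ≡ 1
  accepts≡0⊎1 pre []      = gate≡0⊎1 pre
  accepts≡0⊎1 pre (x ∷ w) with gate≡0⊎1 pre
  ... | inj₁ gate≡0 = inj₁ (cong (_* (𝟙 (allowed? pre (toℕ x)) * accepts (toℕ x ∷ pre) w)) gate≡0)
  ... | inj₂ gate≡1 with allowed? pre (toℕ x) | accepts≡0⊎1 (toℕ x ∷ pre) w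
  ...   | no _  | _       = inj₁ (cong (_* 0) gate≡1)
  ...   | yes _ | inj₁ ≡0 = inj₁ (cong₂ (λ g a → g * (1 * a)) gate≡1 ≡0)
  ...   | yes _ | inj₂ ≡1 = inj₂ (cong₂ (λ g a → g * (1 * a)) gate≡1 ≡1)

  accepts≡1⇒ : ∀ {q} pre (w : Vec (Fin n) q) → accepts pre w ≡ 1 → Accepting pre w
  accepts≡1⇒ pre []      gate≡1 = (λ ()) , λ { zero _ → gate≡1 }
  accepts≡1⇒ pre (x ∷ w) acc≡1  = allowed , gates
    where
    rest≡1 : 𝟙 (allowed? pre (toℕ x)) * accepts (toℕ x ∷ pre) w ≡ 1
    rest≡1 = m*n≡1⇒n≡1 (gate pre) _ acc≡1
    ih : Accepting (toℕ x ∷ pre) w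
    ih = accepts≡1⇒ (toℕ x ∷ pre) w (m*n≡1⇒n≡1 (𝟙 (allowed? pre (toℕ x))) _ rest≡1)
    allowed : ∀ i → Allowed (stateAfter pre (x ∷ w) (toℕ i)) (toℕ (lookup (x ∷ w) i))
    allowed Fin.zero    = 𝟙≡1⇒ (allowed? pre (toℕ x)) (m*n≡1⇒m≡1 _ (accepts (toℕ x ∷ pre) w) rest≡1)
    allowed (Fin.suc i) = proj₁ ih i
    gates : ∀ k → k ≤ suc _ → gate (stateAfter pre (x ∷ w) k) ≡ 1
    gates zero    _         = m*n≡1⇒m≡1 (gate pre) _ acc≡1
    gates (suc k) (s≤s k≤q) = proj₂ ih k k≤q

  ⇒accepts≡1 : ∀ {q} pre (w : Vec (Fin n) q) → Accepting pre w → accepts pre w ≡ 1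
  ⇒accepts≡1 pre []      (_ , gates)       = gates 0 z≤n
  ⇒accepts≡1 pre (x ∷ w) (allowed , gates) =
    trans (cong₂ (λ g a → g * (a * accepts (toℕ x ∷ pre) w)) (gates 0 z≤n) (𝟙-yes (allowed? pre (toℕ x)) (allowed Fin.zero)))
          (trans (+-identityʳ _) (trans (+-identityʳ _)
                 (⇒accepts≡1 (toℕ x ∷ pre) w (allowed ∘ Fin.suc , λ k k≤q → gates (suc k) (s≤s k≤q)))))

  gate≡1⇒ : ∀ pre → length pre ≡ r → gate pre ≡ 1 → (∀ v → v < m → v ∈ pre) × ¬ TopDue pre
  gate≡1⇒ pre len≡r gate≡1 with leftCount-done (topDue pre) (#small pre) (#candidates pre)
  ... | inj₂ ≡0 = contradiction (trans (sym ≡0) (trans (sym (gate-end pre len≡r)) gate≡1)) 0≢1+n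
  ... | inj₁ (e≡0 , a≡0) =
    (λ v v<m → decidable-stable (v ∈? pre) (count≡0⇒ (unseen? pre) m a≡0 v v<m)) ,
    (λ due → 0≢1+n (trans (sym e≡0) (𝟙-yes (topDue? pre) due)))

  ⇒gate≡1 : ∀ pre → (∀ v → v < m → v ∈ pre) → ¬ TopDue pre → gate pre ≡ 1
  ⇒gate≡1 pre smallSeen notDue with length pre ≟ r
  ... | no _  = refl
  ... | yes _ = leftCount-cong 0 (𝟙-no (topDue? pre) notDue) (count≡0 (unseen? pre) m (λ v v<m v∉ → v∉ (smallSeen v v<m))) refl

-- Acceptance, position by position

module Positions {n} (r : ℕ) (w : Word n) where

  val : Fin n → ℕ
  val i = toℕ (lookup w i)

  ReadBefore : ℕ → ℕ → Set
  ReadBefore k v = ∃ λ j → toℕ j < k × val j ≡ v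

  record Accepted (m M : ℕ) : Set where
    field
      distinct        : ∀ i → ¬ ReadBefore (toℕ i) (val i)
      left-≢m         : ∀ i → toℕ i < r → val i ≢ m
      left-<M         : ∀ i → toℕ i < r → val i < M
      left-large-dec  : ∀ i → toℕ i < r → m < val i → ∀ j → toℕ j < toℕ i → m < val j → val i < val j
      left-large-top  : ∀ i → toℕ i < r → m < val i → val i ≡ pred M ⊎ ReadBefore (toℕ i) (pred M)
      right-small-dec : ∀ i → r ≤ toℕ i → val i < M → ∀ {y} → y < M → ¬ ReadBefore (toℕ i) y → y ≤ val i
      small-left      : ∀ v → v < m → ReadBefore r v
      top-left        : m < M → ReadBefore r (pred M)

  module _ (r≤n : r ≤ n) (m M : ℕ) where
    open Automaton n r m M

    state : ℕ → List ℕ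
    state = stateAfter [] w

    ∈-state⇒ : ∀ k {v} → v ∈ state k → ReadBefore k v
    ∈-state⇒ k v∈ with ∈-stateAfter⁻ [] w k v∈
    ... | inj₂ readBefore = readBefore

    ⇒∈-state : ∀ k {v} → ReadBefore k v → v ∈ state k
    ⇒∈-state k (j , j<k , refl) = ∈-stateAfter⁺ [] w k j j<k

    length-state : ∀ (i : Fin n) → length (state (toℕ i)) ≡ toℕ i
    length-state i = length-stateAfter [] w (toℕ i) (<⇒≤ (toℕ<n i))

    accepts≡1⇒Accepted : accepts [] w ≡ 1 → Accepted m M
    accepts≡1⇒Accepted acc≡1 = record
      { distinct        = λ i readBefore → proj₁ (allowed i) (⇒∈-state (toℕ i) readBefore)
      ; left-≢m         = λ i i<r → proj₁ (left i i<r)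
      ; left-<M         = λ i i<r → proj₁ (proj₂ (left i i<r))
      ; left-large-dec  = λ i i<r m<vi j j<i m<vj →
                            All.lookup (proj₁ (proj₂ (proj₂ (left i i<r)) m<vi)) (⇒∈-state (toℕ i) (j , j<i , refl)) m<vj
      ; left-large-top  = λ i i<r m<vi → Sum.map₂ (∈-state⇒ (toℕ i)) (proj₂ (proj₂ (proj₂ (left i i<r)) m<vi))
      ; right-small-dec = λ i r≤i vi<M y<M ¬read →
                            proj₂ (proj₂ (allowed i)) (subst (r ≤_) (sym (length-state i)) r≤i)
                                  vi<M y<M (¬read ∘ ∈-state⇒ (toℕ i))
      ; small-left      = λ v v<m → ∈-state⇒ r (proj₁ endGate v v<m)
      ; top-left        = λ m<M → ∈-state⇒ r (decidable-stable (pred M ∈? state r) (λ top∉ → proj₂ endGate (m<M , top∉)))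
      }
      where
      run : Accepting [] w
      run = accepts≡1⇒ [] w acc≡1
      allowed : ∀ i → Allowed (state (toℕ i)) (val i)
      allowed = proj₁ run
      left : ∀ i → toℕ i < r → LeftStep (state (toℕ i)) (val i)
      left i i<r = proj₁ (proj₂ (allowed i)) (subst (_< r) (sym (length-state i)) i<r)
      endGate : (∀ v → v < m → v ∈ state r) × ¬ TopDue (state r)
      endGate = gate≡1⇒ (state r) (length-stateAfter [] w r r≤n) (proj₂ run r r≤n)

    Accepted⇒accepts≡1 : Accepted m M → accepts [] w ≡ 1
    Accepted⇒accepts≡1 acc = ⇒accepts≡1 [] w (allowed , gates)
      where
      open Accepted acc
      allowed : ∀ i → Allowed (state (toℕ i)) (val i)
      allowed i = distinct i ∘ ∈-state⇒ (toℕ i) , left , right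
        where
        left : length (state (toℕ i)) < r → LeftStep (state (toℕ i)) (val i)
        left len<r = left-≢m i i<r , left-<M i i<r , λ m<vi →
            All.tabulate (below-earlier m<vi ∘ ∈-state⇒ (toℕ i)) ,
            Sum.map₂ (⇒∈-state (toℕ i)) (left-large-top i i<r m<vi)
          where
          i<r : toℕ i < r
          i<r = subst (_< r) (length-state i) len<r
          below-earlier : m < val i → ∀ {z} → ReadBefore (toℕ i) z → m < z → val i < z
          below-earlier m<vi (j , j<i , refl) = left-large-dec i i<r m<vi j j<i
        right : r ≤ length (state (toℕ i)) → RightStep (state (toℕ i)) (val i)
        right r≤len vi<M y<M y∉ = right-small-dec i (subst (r ≤_) (length-state i) r≤len) vi<M y<M (y∉ ∘ ⇒∈-state (toℕ i))
      gates : ∀ k → k ≤ n → gate (state k) ≡ 1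
      gates k k≤n with k ≟ r
      ... | yes refl = ⇒gate≡1 (state k) (λ v v<m → ⇒∈-state k (small-left v v<m))
                                         (λ (m<M , top∉) → top∉ (⇒∈-state k (top-left m<M)))
      ... | no k≢r   = gate-inside (state k) (k≢r ∘ trans (sym (length-stateAfter [] w k k≤n)))

  ReadBefore-mono : ∀ {k k′ v} → k ≤ k′ → ReadBefore k v → ReadBefore k′ v
  ReadBefore-mono k≤k′ (j , j<k , vj≡v) = j , <-≤-trans j<k k≤k′ , vj≡v

  val-injective : ∀ {m M} → Accepted m M → ∀ {i j} → val i ≡ val j → i ≡ j
  val-injective acc {i} {j} vi≡vj with FinP.<-cmp i j
  ... | tri< i<j _ _ = contradiction (i , i<j , vi≡vj) (Accepted.distinct acc j)
  ... | tri≈ _ i≡j _ = i≡j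
  ... | tri> _ _ j<i = contradiction (j , j<i , sym vi≡vj) (Accepted.distinct acc i)

  Accepted⇒InK : ∀ {m M} → Accepted m M → InK r w
  Accepted⇒InK {m} {M} acc = (λ i j wi≡wj → val-injective acc (cong toℕ wi≡wj)) , no3|12 , no23|1
    where
    open Accepted acc
    no3|12 : ¬ Contains3|12 r w
    no3|12 (i₁ , i₂ , i₃ , i₁<r , r≤i₂ , i₂<i₃ , v₂<v₃ , v₃<v₁) =
      <⇒≱ v₂<v₃ (right-small-dec i₂ r≤i₂ (<-trans v₂<v₃ v₃<M) v₃<M (distinct i₃ ∘ ReadBefore-mono (<⇒≤ i₂<i₃)))
      where
      v₃<M : val i₃ < M
      v₃<M = <-trans v₃<v₁ (left-<M i₁ i₁<r)
    no23|1 : ¬ Contains23|1 r w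
    no23|1 (i₁ , i₂ , i₃ , i₁<i₂ , i₂<r , r≤i₃ , v₃<v₁ , v₁<v₂) =
      <-asym v₁<v₂ (left-large-dec i₂ i₂<r (<-trans m<v₁ v₁<v₂) i₁ i₁<i₂ m<v₁)
      where
      m≤v₃ : m ≤ val i₃
      m≤v₃ = ≮⇒≥ λ v₃<m → distinct i₃ (ReadBefore-mono r≤i₃ (small-left (val i₃) v₃<m))
      m<v₁ : m < val i₁
      m<v₁ = ≤-<-trans m≤v₃ v₃<v₁

  Accepted-unique : ∀ {m M m′ M′} → Accepted m M → Accepted m′ M′ → m ≡ m′ × M ≡ M′
  Accepted-unique {m} {M} {m′} {M′} acc acc′ = m≡m′ , M≡M′
    where
    ¬m<m′ : ∀ {m M m′ M′} → Accepted m M → Accepted m′ M′ → ¬ m < m′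
    ¬m<m′ {m} acc acc′ m<m′ with j , j<r , vj≡m ← Accepted.small-left acc′ m m<m′ = Accepted.left-≢m acc j j<r vj≡m
    ¬M<M′ : ∀ {m M M′} → Accepted m M → Accepted m M′ → ¬ M < M′
    ¬M<M′ {m} {M} {M′} acc acc′ M<M′ with m <? M′
    ... | yes m<M′ with j , j<r , vj≡top ← Accepted.top-left acc′ m<M′ =
      <⇒≱ M<M′ (pred<⇒≤ (subst (_< M) vj≡top (Accepted.left-<M acc j j<r)))
    ... | no m≮M′ with j , j<r , vj≡M ← Accepted.small-left acc M (<-≤-trans M<M′ (≮⇒≥ m≮M′)) =
      <-irrefl vj≡M (Accepted.left-<M acc j j<r)
    m≡m′ : m ≡ m′
    m≡m′ = ≮∧≯⇒≡ (¬m<m′ acc acc′) (¬m<m′ acc′ acc)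
    acc″ : Accepted m M′
    acc″ = subst (λ x → Accepted x M′) (sym m≡m′) acc′
    M≡M′ : M ≡ M′
    M≡M′ = ≮∧≯⇒≡ (¬M<M′ acc acc″) (¬M<M′ acc″ acc)

  module _ (inK : InK r w) where

    avoids3|12 : ¬ Contains3|12 r w
    avoids3|12 = proj₁ (proj₂ inK)

    avoids23|1 : ¬ Contains23|1 r w
    avoids23|1 = proj₂ (proj₂ inK)

    perm-val-injective : ∀ {i j} → val i ≡ val j → i ≡ j
    perm-val-injective {i} {j} vi≡vj = proj₁ inK i j (FinP.toℕ-injective vi≡vj)

    val-surjective : ∀ {v} → v < n → ∃ λ j → val j ≡ v
    val-surjective {v} v<n with j , wj≡v ← Fin-injective⇒surjective (lookup w) (proj₁ inK _ _) (Fin.fromℕ< v<n) =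
      j , trans (cong toℕ wj≡v) (FinP.toℕ-fromℕ< v<n)

    rightPositions leftPositions : List (Fin n)
    rightPositions = filter (λ i → r ≤? toℕ i) (allFin n)
    leftPositions  = filter (λ i → toℕ i <? r) (allFin n)

    rightValues leftSuccs : List ℕ
    rightValues = map val rightPositions
    leftSuccs   = map (suc ∘ val) leftPositions

    m₀ M₀ : ℕ
    m₀ = min n rightValues
    M₀ = max 0 leftSuccs

    m₀≤n : m₀ ≤ n
    m₀≤n = min≤⊤ n rightValues

    m₀≤right : ∀ i → r ≤ toℕ i → m₀ ≤ val i
    m₀≤right i r≤i = All.lookup (min≤xs n rightValues)
                       (∈-map⁺ val (∈-filter⁺ (λ i → r ≤? toℕ i) (∈-allFin i) r≤i))

    m₀-attained : m₀ < n → ∃ λ p → r ≤ toℕ p × val p ≡ m₀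
    m₀-attained m₀<n with argmin-sel id n rightValues
    ... | inj₁ m₀≡n = contradiction m₀≡n (<⇒≢ m₀<n)
    ... | inj₂ m₀∈  with p , p∈ , m₀≡vp ← ∈-map⁻ val {xs = rightPositions} m₀∈ =
      p , proj₂ (∈-filter⁻ (λ i → r ≤? toℕ i) {xs = allFin n} p∈) , sym m₀≡vp

    left<M₀ : ∀ i → toℕ i < r → val i < M₀
    left<M₀ i i<r = All.lookup (xs≤max 0 leftSuccs)
                      (∈-map⁺ (suc ∘ val) (∈-filter⁺ (λ i → toℕ i <? r) (∈-allFin i) i<r))

    M₀-attained : 0 < M₀ → ∃ λ q → toℕ q < r × suc (val q) ≡ M₀
    M₀-attained 0<M₀ with argmax-sel id 0 leftSuccs
    ... | inj₁ M₀≡0 = contradiction (sym M₀≡0) (<⇒≢ 0<M₀)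
    ... | inj₂ M₀∈  with q , q∈ , M₀≡1+vq ← ∈-map⁻ (suc ∘ val) {xs = leftPositions} M₀∈ =
      q , proj₂ (∈-filter⁻ (λ i → toℕ i <? r) {xs = allFin n} q∈) , sym M₀≡1+vq

    M₀≤n : M₀ ≤ n
    M₀≤n = max≤v⁺ {xs = leftSuccs} z≤n (All.tabulate λ x∈ →
             let (i , _ , x≡1+vi) = ∈-map⁻ (suc ∘ val) {xs = leftPositions} x∈
             in subst (_≤ n) (sym x≡1+vi) (toℕ<n (lookup w i)))

    left-≢m₀ : ∀ i → toℕ i < r → val i ≢ m₀
    left-≢m₀ i i<r vi≡m₀ with p , r≤p , vp≡m₀ ← m₀-attained (subst (_< n) vi≡m₀ (toℕ<n (lookup w i)))
                           with refl ← perm-val-injective (trans vi≡m₀ (sym vp≡m₀)) = <⇒≱ i<r r≤p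

    -- Two left values above m₀ out of decreasing order would form 23|1 with m₀.
    left-large-dec : ∀ i → toℕ i < r → m₀ < val i → ∀ j → toℕ j < toℕ i → m₀ < val j → val i < val j
    left-large-dec i i<r m₀<vi j j<i m₀<vj with <-cmp (val i) (val j)
    ... | tri< vi<vj _ _ = vi<vj
    ... | tri≈ _ vi≡vj _ with refl ← perm-val-injective vi≡vj = contradiction j<i (<-irrefl refl)
    ... | tri> _ _ vj<vi with p , r≤p , vp≡m₀ ← m₀-attained (<-trans m₀<vi (toℕ<n (lookup w i))) =
      ⊥-elim (avoids23|1 (j , i , p , j<i , i<r , r≤p , subst (_< val j) (sym vp≡m₀) m₀<vj , vj<vi))

    -- The first left value above m₀ must be the largest left value, again by 23|1.
    left-large-top : ∀ i → toℕ i < r → m₀ < val i → val i ≡ pred M₀ ⊎ ReadBefore (toℕ i) (pred M₀)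
    left-large-top i i<r m₀<vi with q , q<r , 1+vq≡M₀ ← M₀-attained (≤-<-trans z≤n (left<M₀ i i<r))
                               with <-cmp (toℕ q) (toℕ i)
    ... | tri< q<i _ _ = inj₂ (q , q<i , cong pred 1+vq≡M₀)
    ... | tri≈ _ q≡i _ with refl ← FinP.toℕ-injective q≡i = inj₁ (cong pred 1+vq≡M₀)
    ... | tri> _ _ i<q with p , r≤p , vp≡m₀ ← m₀-attained (<-trans m₀<vi (toℕ<n (lookup w i))) =
      ⊥-elim (avoids23|1 (i , q , p , i<q , q<r , r≤p , subst (_< val i) (sym vp≡m₀) m₀<vi , vi<vq))
      where
      vi<vq : val i < val q
      vi<vq = ≤∧≢⇒< (≤-pred (subst (val i <_) (sym 1+vq≡M₀) (left<M₀ i i<r)))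
                    (λ vi≡vq → <⇒≢ i<q (cong toℕ (perm-val-injective vi≡vq)))

    -- A right value below M₀ followed by a larger one below M₀ would form 3|12 with M₀ − 1.
    right-small-dec : ∀ i → r ≤ toℕ i → val i < M₀ → ∀ {y} → y < M₀ → ¬ ReadBefore (toℕ i) y → y ≤ val i
    right-small-dec i r≤i _ {y} y<M₀ unread with y ≤? val i
    ... | yes y≤vi = y≤vi
    ... | no y≰vi with j , vj≡y ← val-surjective (<-≤-trans y<M₀ M₀≤n)
                  with <-cmp (toℕ j) (toℕ i)
    ... | tri< j<i _ _ = contradiction (j , j<i , vj≡y) unread
    ... | tri≈ _ j≡i _ = contradiction (≤-reflexive (trans (sym vj≡y) (cong val (FinP.toℕ-injective j≡i)))) y≰vi
    ... | tri> _ _ i<j with q , q<r , 1+vq≡M₀ ← M₀-attained (≤-<-trans z≤n y<M₀) =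
      ⊥-elim (avoids3|12 (q , i , j , q<r , r≤i , i<j ,
                          subst (val i <_) (sym vj≡y) (≰⇒> y≰vi) , subst (_< val q) (sym vj≡y) y<vq))
      where
      y<vq : y < val q
      y<vq = ≤∧≢⇒< (≤-pred (subst (y <_) (sym 1+vq≡M₀) y<M₀))
                   (λ y≡vq → <⇒≱ q<r (≤-trans r≤i (<⇒≤ (subst (λ k → toℕ i < toℕ k)
                                                               (perm-val-injective (trans vj≡y y≡vq)) i<j))))

    small-left : ∀ v → v < m₀ → ReadBefore r v
    small-left v v<m₀ with j , vj≡v ← val-surjective (<-≤-trans v<m₀ m₀≤n) with r ≤? toℕ j
    ... | yes r≤j = contradiction (subst (m₀ ≤_) vj≡v (m₀≤right j r≤j)) (<⇒≱ v<m₀)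
    ... | no r≰j  = j , ≰⇒> r≰j , vj≡v

    top-left : m₀ < M₀ → ReadBefore r (pred M₀)
    top-left m₀<M₀ with q , q<r , 1+vq≡M₀ ← M₀-attained (≤-<-trans z≤n m₀<M₀) = q , q<r , cong pred 1+vq≡M₀

    m₀-M₀-gap : Gap m₀ M₀
    m₀-M₀-gap with <-cmp m₀ M₀
    ... | tri≈ _ m₀≡M₀ _ = inj₁ m₀≡M₀
    ... | tri> _ _ M₀<m₀ with j , j<r , vj≡M₀ ← small-left M₀ M₀<m₀ = contradiction (left<M₀ j j<r) (<-irrefl vj≡M₀)
    ... | tri< m₀<M₀ _ _ with suc m₀ ≟ M₀
    ...   | no 1+m₀≢M₀ = inj₂ (≤∧≢⇒< m₀<M₀ 1+m₀≢M₀)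
    ...   | yes 1+m₀≡M₀ with q , q<r , 1+vq≡M₀ ← M₀-attained (≤-<-trans z≤n m₀<M₀) =
      contradiction (suc-injective (trans 1+vq≡M₀ (sym 1+m₀≡M₀))) (left-≢m₀ q q<r)

    InK⇒Accepted : Accepted m₀ M₀
    InK⇒Accepted = record
      { distinct        = λ i (j , j<i , vj≡vi) → <-irrefl (cong toℕ (perm-val-injective vj≡vi)) j<i
      ; left-≢m         = left-≢m₀
      ; left-<M         = left<M₀
      ; left-large-dec  = left-large-dec
      ; left-large-top  = left-large-top
      ; right-small-dec = right-small-dec
      ; small-left      = small-left
      ; top-left        = top-left
      }

-- Counting K(r,n)

module _ {n} (r : ℕ) (r≤n : r ≤ n) (w : Word n) where
  open Positions r w

  accepts≡0 : ∀ m M → ¬ Accepted m M → Automaton.accepts n r m M [] w ≡ 0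
  accepts≡0 m M ¬acc with Automaton.accepts≡0⊎1 n r m M [] w
  ... | inj₁ ≡0 = ≡0
  ... | inj₂ ≡1 = contradiction (accepts≡1⇒Accepted r≤n m M ≡1) ¬acc

  -- A word of K(r,n) is accepted for exactly one admissible pair (m, M), any other word for none.
  𝟙-InK≡Σ-accepts : 𝟙 (inK? r w) ≡ Σ< (suc n) (λ m → Σ< (suc n) (λ M → 𝟙 (gap? m M) * Automaton.accepts n r m M [] w))
  𝟙-InK≡Σ-accepts with inK? r w
  ... | no ¬inK = sym (Σ<-zero (suc n) λ m _ → Σ<-zero (suc n) λ M _ →
                    trans (cong (𝟙 (gap? m M) *_) (accepts≡0 m M (¬inK ∘ Accepted⇒InK))) (*-zeroʳ (𝟙 (gap? m M))))
  ... | yes inK = sym (begin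
    Σ< (suc n) (λ m → Σ< (suc n) (λ M → 𝟙 (gap? m M) * accepts m M))
      ≡⟨ Σ<-single (suc n) (m₀ inK) (s≤s (m₀≤n inK)) (λ m _ m≢m₀ → Σ<-zero (suc n) λ M _ →
           trans (cong (𝟙 (gap? m M) *_) (accepts≡0 m M (m≢m₀ ∘ proj₁ ∘ flip Accepted-unique accepted)))
                 (*-zeroʳ (𝟙 (gap? m M)))) ⟩
    Σ< (suc n) (λ M → 𝟙 (gap? (m₀ inK) M) * accepts (m₀ inK) M)
      ≡⟨ Σ<-single (suc n) (M₀ inK) (s≤s (M₀≤n inK)) (λ M _ M≢M₀ →
           trans (cong (𝟙 (gap? (m₀ inK) M) *_) (accepts≡0 (m₀ inK) M (M≢M₀ ∘ proj₂ ∘ flip Accepted-unique accepted)))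
                 (*-zeroʳ (𝟙 (gap? (m₀ inK) M)))) ⟩
    𝟙 (gap? (m₀ inK) (M₀ inK)) * accepts (m₀ inK) (M₀ inK)
      ≡⟨ cong₂ _*_ (𝟙-yes (gap? (m₀ inK) (M₀ inK)) (m₀-M₀-gap inK)) (Accepted⇒accepts≡1 r≤n (m₀ inK) (M₀ inK) accepted) ⟩
    1 ∎)
    where
    accepts : ℕ → ℕ → ℕ
    accepts m M = Automaton.accepts n r m M [] w
    accepted : Accepted (m₀ inK) (M₀ inK)
    accepted = InK⇒Accepted inK

#accepted : ℕ → ℕ → ℕ → ℕ → ℕ
#accepted n r m M = leftCount (𝟙 (m <? M)) m (pred M ∸ suc m) r * ff (n ∸ r) (n ∸ M)

completions-[] : ∀ n r m M → M ≤ n → Automaton.completions n r m M [] ≡ #accepted n r m M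
completions-[] n r m M M≤n = begin
  completions []
    ≡⟨ completions-left [] z≤n ⟩
  leftCount (topDue []) (#small []) (#candidates []) r * ff (n ∸ r) (#large [])
    ≡⟨ cong₂ (λ l t → l * ff (n ∸ r) t) (leftCount-cong r topDue≡ #small≡ #candidates≡) #large≡ ⟩
  #accepted n r m M ∎
  where
  open Automaton n r m M
  topDue≡ : topDue [] ≡ 𝟙 (m <? M)
  topDue≡ = 𝟙-cong (topDue? []) (m <? M) proj₁ (λ m<M → m<M , λ ())
  #small≡ : #small [] ≡ m
  #small≡ = trans (Σ<-const m 1) (*-identityʳ m)
  #candidates≡ : #candidates [] ≡ pred M ∸ suc m
  #candidates≡ = trans (count-cong (candidate? []) (λ v → suc m ≤? v ×-dec v <? pred M) n
                                   (λ v _ (_ , m<v , v+1<M , _) → m<v , suc<⇒<pred v+1<M)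
                                   (λ v _ (m<v , v<top) → (λ ()) , m<v , <pred⇒suc< v<top , []))
                       (count-range n (suc m) (pred M) (≤-trans pred[n]≤n M≤n))
  #large≡ : #large [] ≡ n ∸ M
  #large≡ = trans (count-cong (large? []) (λ v → M ≤? v ×-dec v <? n) n
                              (λ v v<n (_ , M≤v) → M≤v , v<n) (λ v _ (M≤v , _) → (λ ()) , M≤v))
                  (count-range n M n ≤-refl)

k≡Σ-#accepted : ∀ r n → r ≤ n → k r n ≡ Σ< (suc n) (λ m → Σ< (suc n) (λ M → 𝟙 (gap? m M) * #accepted n r m M))
k≡Σ-#accepted r n r≤n = begin
  k r n
    ≡⟨ length-filter (inK? r) words ⟩
  Σᴸ (λ w → 𝟙 (inK? r w)) words
    ≡⟨ Σᴸ-cong words (𝟙-InK≡Σ-accepts r r≤n) ⟩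
  Σᴸ (λ w → Σ< (suc n) (λ m → Σ< (suc n) (λ M → 𝟙 (gap? m M) * Automaton.accepts n r m M [] w))) words
    ≡⟨ Σᴸ-Σ< (suc n) _ words ⟩
  Σ< (suc n) (λ m → Σᴸ (λ w → Σ< (suc n) (λ M → 𝟙 (gap? m M) * Automaton.accepts n r m M [] w)) words)
    ≡⟨ Σ<-cong (suc n) (λ m m<1+n → trans (Σᴸ-Σ< (suc n) _ words) (Σ<-cong (suc n) (λ M M<1+n →
         trans (Σᴸ-*ˡ (𝟙 (gap? m M)) _ words) (𝟙*-cong (gap? m M) (Σ-accepts-[] m M (≤-pred m<1+n) (≤-pred M<1+n)))))) ⟩
  Σ< (suc n) (λ m → Σ< (suc n) (λ M → 𝟙 (gap? m M) * #accepted n r m M)) ∎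
  where
  words : List (Word n)
  words = allWords (allFin n) n
  Σ-accepts-[] : ∀ m M → m ≤ n → M ≤ n → Gap m M →
                 Σᴸ (Automaton.accepts n r m M []) words ≡ #accepted n r m M
  Σ-accepts-[] m M m≤n M≤n gap =
    trans (Automaton.Counting.Σ-accepts n r m M r≤n m≤n M≤n gap n [] refl (Automaton.Invariant-[] n r m M))
          (completions-[] n r m M M≤n)

#accepted-diag : ∀ n r m → #accepted n r m m ≡ (0 C (r ∸ m)) * ff r m * ff (n ∸ r) (n ∸ m)
#accepted-diag n r m = cong (_* ff (n ∸ r) (n ∸ m)) (leftCount-cong r (𝟙-no (m <? m) (<-irrefl refl)) refl
                                                                      (m≤n⇒m∸n≡0 (≤-trans pred[n]≤n (n≤1+n m))))

#accepted-gap : ∀ n r m M → 2 + m ≤ M →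
                #accepted n r m M ≡ 𝟙 (m <? r) * (((pred M ∸ suc m) C (r ∸ suc m)) * ff r m) * ff (n ∸ r) (n ∸ M)
#accepted-gap n r m M 2+m≤M =
  cong (_* ff (n ∸ r) (n ∸ M)) (leftCount-cong r (𝟙-yes (m <? M) (<-trans (n<1+n m) 2+m≤M)) refl refl)

Σ-diagonal : ∀ r n → r ≤ n → Σ< (suc n) (λ m → #accepted n r m m) ≡ r ! * (n ∸ r) !
Σ-diagonal r n r≤n = begin
  Σ< (suc n) (λ m → #accepted n r m m)               ≡⟨ Σ<-single (suc n) r (s≤s r≤n) off-diagonal≡0 ⟩
  #accepted n r r r                                   ≡⟨ #accepted-diag n r r ⟩
  (0 C (r ∸ r)) * ff r r * ff (n ∸ r) (n ∸ r)         ≡⟨ cong (λ i → (0 C i) * ff r r * ff (n ∸ r) (n ∸ r)) (n∸n≡0 r) ⟩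
  1 * ff r r * ff (n ∸ r) (n ∸ r)                     ≡⟨ cong₂ _*_ (trans (*-identityˡ (ff r r)) (ff-diag r)) (ff-diag (n ∸ r)) ⟩
  r ! * (n ∸ r) !                                     ∎
  where
  off-diagonal≡0 : ∀ m → m < suc n → m ≢ r → #accepted n r m m ≡ 0
  off-diagonal≡0 m _ m≢r = trans (#accepted-diag n r m) (by-cases (<-cmp m r))
    where
    by-cases : Tri (m < r) (m ≡ r) (r < m) → (0 C (r ∸ m)) * ff r m * ff (n ∸ r) (n ∸ m) ≡ 0
    by-cases (tri< m<r _ _) = cong (λ c → c * ff r m * ff (n ∸ r) (n ∸ m)) (k>n⇒nCk≡0 (m<n⇒0<n∸m m<r))
    by-cases (tri≈ _ m≡r _) = contradiction m≡r m≢r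
    by-cases (tri> _ _ r<m) = cong (λ f → f * ff (n ∸ r) (n ∸ m))
                                   (trans (cong ((0 C (r ∸ m)) *_) (ff-vanish r<m)) (*-zeroʳ (0 C (r ∸ m))))

𝟙*#accepted-M≤r : ∀ n r m M → M ≤ r → 𝟙 (2 + m ≤? M) * #accepted n r m M ≡ 0
𝟙*#accepted-M≤r n r m M M≤r with 2 + m ≤? M
... | no _      = refl
... | yes 2+m≤M = trans (+-identityʳ _) (trans (#accepted-gap n r m M 2+m≤M)
    (trans (cong (λ c → 𝟙 (m <? r) * (c * ff r m) * ff (n ∸ r) (n ∸ M)) (k>n⇒nCk≡0 (∸-monoˡ-< top<r (suc<⇒<pred 2+m≤M))))
           (cong (_* ff (n ∸ r) (n ∸ M)) (*-zeroʳ (𝟙 (m <? r))))))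
  where
  top<r : pred M < r
  top<r = <-≤-trans (pred< (suc<⇒<pred 2+m≤M)) M≤r

𝟙*#accepted-n∸j : ∀ n r m j → m < r → r < n ∸ j → j ≤ n →
                  𝟙 (2 + m ≤? n ∸ j) * #accepted n r m (n ∸ j) ≡ ((n ∸ suc m ∸ suc j) C (r ∸ suc m)) * ff r m * ff (n ∸ r) j
𝟙*#accepted-n∸j n r m j m<r r<n∸j j≤n = begin
  𝟙 (2 + m ≤? n ∸ j) * #accepted n r m (n ∸ j)
    ≡⟨ cong (_* #accepted n r m (n ∸ j)) (𝟙-yes (2 + m ≤? n ∸ j) 2+m≤n∸j) ⟩
  1 * #accepted n r m (n ∸ j)
    ≡⟨ *-identityˡ _ ⟩
  #accepted n r m (n ∸ j)
    ≡⟨ #accepted-gap n r m (n ∸ j) 2+m≤n∸j ⟩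
  𝟙 (m <? r) * (((pred (n ∸ j) ∸ suc m) C (r ∸ suc m)) * ff r m) * ff (n ∸ r) (n ∸ (n ∸ j))
    ≡⟨ cong₂ (λ i c → i * ((c C (r ∸ suc m)) * ff r m) * ff (n ∸ r) (n ∸ (n ∸ j))) (𝟙-yes (m <? r) m<r) top∸[1+m] ⟩
  1 * (((n ∸ suc m ∸ suc j) C (r ∸ suc m)) * ff r m) * ff (n ∸ r) (n ∸ (n ∸ j))
    ≡⟨ cong₂ _*_ (*-identityˡ (((n ∸ suc m ∸ suc j) C (r ∸ suc m)) * ff r m)) (cong (ff (n ∸ r)) (m∸[m∸n]≡n j≤n)) ⟩
  ((n ∸ suc m ∸ suc j) C (r ∸ suc m)) * ff r m * ff (n ∸ r) j ∎
  where
  2+m≤n∸j : 2 + m ≤ n ∸ j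
  2+m≤n∸j = ≤-trans (s≤s m<r) r<n∸j
  top∸[1+m] : pred (n ∸ j) ∸ suc m ≡ n ∸ suc m ∸ suc j
  top∸[1+m] = trans (cong (_∸ suc m) (pred[m∸n]≡m∸[1+n] n j)) (∸-swap n (suc j) (suc m))

Σ-offDiagonal-row : ∀ r n m → m < r → r ≤ n →
  Σ< (suc n) (λ M → 𝟙 (2 + m ≤? M) * #accepted n r m M)
  ≡ Σ< (n ∸ r) (λ j → ((n ∸ suc m ∸ suc j) C (r ∸ suc m)) * ff r m * ff (n ∸ r) j)
Σ-offDiagonal-row r n m m<r r≤n with e , refl ← m≤n⇒∃[o]m+o≡n r≤n = begin
  Σ< (suc (r + e)) f                     ≡⟨ Σ<-reverse-tail r e f (𝟙*#accepted-M≤r n r m) ⟩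
  Σ< e (λ j → f (r + e ∸ j))             ≡⟨ Σ<-cong e (λ j j<e → 𝟙*#accepted-n∸j n r m j m<r (r<r+e∸j j<e)
                                                                  (≤-trans (<⇒≤ j<e) (m≤n+m e r))) ⟩
  Σ< e g                                 ≡⟨ cong (λ K → Σ< K g) (m+n∸m≡n r e) ⟨
  Σ< (r + e ∸ r) g                       ∎
  where
  f g : ℕ → ℕ
  f M = 𝟙 (2 + m ≤? M) * #accepted n r m M
  g j = ((n ∸ suc m ∸ suc j) C (r ∸ suc m)) * ff r m * ff (n ∸ r) j
  r<r+e∸j : ∀ {j} → j < e → r < r + e ∸ j
  r<r+e∸j j<e = subst (r <_) (sym (+-∸-assoc r (<⇒≤ j<e))) (m<m+n r (m<n⇒0<n∸m j<e))

Σ-offDiagonal : ∀ r n → r ≤ n →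
  Σ< (suc n) (λ m → Σ< (suc n) (λ M → 𝟙 (2 + m ≤? M) * #accepted n r m M))
  ≡ Σ₁ r (λ i → Σ₁ (n ∸ r) (λ j → ((n ∸ i ∸ j) C (r ∸ i)) * ff r (i ∸ 1) * ff (n ∸ r) (j ∸ 1)))
Σ-offDiagonal r n r≤n = begin
  Σ< (suc n) (λ m → Σ< (suc n) (λ M → 𝟙 (2 + m ≤? M) * #accepted n r m M))
    ≡⟨ Σ<-truncate r (suc n) (m≤n⇒m≤1+n r≤n) (λ m r≤m _ → Σ<-zero (suc n) (λ M _ → right-row≡0 m r≤m M)) ⟩
  Σ< r (λ m → Σ< (suc n) (λ M → 𝟙 (2 + m ≤? M) * #accepted n r m M))
    ≡⟨ Σ<-cong r (λ m m<r → Σ-offDiagonal-row r n m m<r r≤n) ⟩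
  Σ< r (λ m → Σ< (n ∸ r) (λ j → ((n ∸ suc m ∸ suc j) C (r ∸ suc m)) * ff r m * ff (n ∸ r) j))
    ≡⟨ Σ<-cong r (λ m _ → Σ₁≡Σ< (n ∸ r) _) ⟨
  Σ< r (λ m → Σ₁ (n ∸ r) (λ j → ((n ∸ suc m ∸ j) C (r ∸ suc m)) * ff r m * ff (n ∸ r) (j ∸ 1)))
    ≡⟨ Σ₁≡Σ< r _ ⟨
  Σ₁ r (λ i → Σ₁ (n ∸ r) (λ j → ((n ∸ i ∸ j) C (r ∸ i)) * ff r (i ∸ 1) * ff (n ∸ r) (j ∸ 1))) ∎
  where
  right-row≡0 : ∀ m → r ≤ m → ∀ M → 𝟙 (2 + m ≤? M) * #accepted n r m M ≡ 0
  right-row≡0 m r≤m M with 2 + m ≤? M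
  ... | no _      = refl
  ... | yes 2+m≤M = trans (+-identityʳ _) (trans (#accepted-gap n r m M 2+m≤M)
      (cong (λ i → i * (((pred M ∸ suc m) C (r ∸ suc m)) * ff r m) * ff (n ∸ r) (n ∸ M)) (𝟙-no (m <? r) (≤⇒≯ r≤m))))

Σ-gap : ∀ n m (f : ℕ → ℕ) → m ≤ n →
        Σ< (suc n) (λ M → 𝟙 (gap? m M) * f M) ≡ f m + Σ< (suc n) (λ M → 𝟙 (2 + m ≤? M) * f M)
Σ-gap n m f m≤n = begin
  Σ< (suc n) (λ M → 𝟙 (gap? m M) * f M)
    ≡⟨ Σ<-𝟙-split (gap? m) (m ≟_) (2 + m ≤?_) (suc n) f (λ M → 𝟙-⊎ (gap? m M) (m ≟ M) (2 + m ≤? M) id inj₁ inj₂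
                                                          (λ { refl 2+m≤m → <-irrefl refl (<-trans (n<1+n m) 2+m≤m) })) ⟩
  Σ< (suc n) (λ M → 𝟙 (m ≟ M) * f M) + Σ< (suc n) (λ M → 𝟙 (2 + m ≤? M) * f M)
    ≡⟨ cong (_+ Σ< (suc n) (λ M → 𝟙 (2 + m ≤? M) * f M)) diagonal ⟩
  f m + Σ< (suc n) (λ M → 𝟙 (2 + m ≤? M) * f M) ∎
  where
  diagonal : Σ< (suc n) (λ M → 𝟙 (m ≟ M) * f M) ≡ f m
  diagonal = trans (Σ<-single (suc n) m (s≤s m≤n) (λ M _ M≢m → cong (_* f M) (𝟙-no (m ≟ M) (M≢m ∘ sym))))
                   (trans (cong (_* f m) (𝟙-yes (m ≟ m) refl)) (*-identityˡ (f m)))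

theorem1p2 : (r n : ℕ) → r ≤ n → k r n ≡ rhs r n
theorem1p2 r n r≤n = begin
  k r n
    ≡⟨ k≡Σ-#accepted r n r≤n ⟩
  Σ< (suc n) (λ m → Σ< (suc n) (λ M → 𝟙 (gap? m M) * #accepted n r m M))
    ≡⟨ Σ<-cong (suc n) (λ m m<1+n → Σ-gap n m (#accepted n r m) (≤-pred m<1+n)) ⟩
  Σ< (suc n) (λ m → #accepted n r m m + Σ< (suc n) (λ M → 𝟙 (2 + m ≤? M) * #accepted n r m M))
    ≡⟨ Σ<-distrib-+ (suc n) _ _ ⟩
  Σ< (suc n) (λ m → #accepted n r m m) + Σ< (suc n) (λ m → Σ< (suc n) (λ M → 𝟙 (2 + m ≤? M) * #accepted n r m M))
    ≡⟨ cong₂ _+_ (Σ-diagonal r n r≤n) (Σ-offDiagonal r n r≤n) ⟩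
  rhs r n ∎
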